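{- Let $G$ be a connected bipartite simple graph with bipartition $(V_1,V_2)$ and edge cone $\mathbb{R}_+\mathcal{A}$. Then there is a unique irreducible representation $$\mathbb{R}_+\mathcal{A}=\mathrm{aff}(\mathbb{R}_+\mathcal{A})\cap\left(\bigcap_{i=1}^r H_{A_i}^-\right)\cap\left(\bigcap_{i\in\mathcal{I}}H_{e_i}^+\right)$$ such that $A_i\subsetneq V_1$ for all $i$ and $v_i\in V_2$ for all $i\in\mathcal{I}$.
   Context: Let $V(G)=\{v_1,\ldots,v_n\}$ and $e_i$ the $i$-th unit vector of $\mathbb{R}^n$. The edge cone $\mathbb{R}_+\mathcal{A}$ is the cone of nonnegative real combinations of the vectors $e_i+e_j$ with $\{v_i,v_j\}$ an edge of $G$; $\mathrm{aff}(\cdot)$ denotes affine hull. $N(A)$ is the set of vertices adjacent to some vertex of $A$. For $A\subset V_1$, $H_A^-=\{x\in\mathbb{R}^n\mid\sum_{v_i\in A}x_i\le\sum_{v_i\in N(A)}x_i\}$, and $H_{e_i}^+=\{x\mid x_i\ge 0\}$. A representation of a polyhedral cone $Q$ as $Q=\mathrm{aff}(Q)\cap\bigcap_{j=1}^s H_j$ with closed halfspaces $H_j$ is called irreducible if for each $j$, omitting $H_j$ from the intersection yields a set different from $Q$.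
   Formalization: Stated over ℚ^n rather than ℝ^n: points have rational coordinates, and the coefficients of the combinations spanning the edge cone and of the affine combinations spanning its affine hull are rational. -}

module Defs where

open import Data.Nat using (ℕ; zero; suc)
open import Data.Bool using (Bool; true; false; _∧_; _∨_; if_then_else_)
open import Data.Fin using (Fin; zero; suc)
open import Data.Fin.Subset using (Subset; _∈_; _∉_; _⊂_)
open import Data.Vec using (Vec; lookup; tabulate)
open import Data.Rational using (ℚ; 0ℚ; 1ℚ; _+_; _*_; _≤_)
open import Data.List using (List; []; _∷_; length; removeAt)
open import Data.List.Relation.Unary.All using (All)
open import Data.List.Membership.Propositional using () renaming (_∈_ to _∈ₗ_)
open import Data.Product using (Σ; _×_; _,_; proj₁; proj₂)
open import Relation.Binary.PropositionalEquality using (_≡_; _≢_)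
open import Relation.Nullary using (¬_)
open import Function.Bundles using (_⇔_)

-- Points of ℚ^n (rationals in place of reals)
Point : ℕ → Set
Point n = Fin n → ℚ

sumFin : {n : ℕ} → (Fin n → ℚ) → ℚ
sumFin {zero}  f = 0ℚ
sumFin {suc n} f = f zero + sumFin (λ i → f (suc i))

anyFin : {n : ℕ} → (Fin n → Bool) → Bool
anyFin {zero}  f = false
anyFin {suc n} f = f zero ∨ anyFin (λ i → f (suc i))

sumOver : {n : ℕ} → Subset n → Point n → ℚ
sumOver A x = sumFin (λ i → if lookup A i then x i else 0ℚ)

Adj : ℕ → Set
Adj n = Fin n → Fin n → Bool

IsSimple : {n : ℕ} → Adj n → Set
IsSimple {n} adj = (∀ i j → adj i j ≡ adj j i) × (∀ i → adj i i ≡ false)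

data Reach {n : ℕ} (adj : Adj n) : Fin n → Fin n → Set where
  here : ∀ {u} → Reach adj u u
  step : ∀ {u v w} → adj u v ≡ true → Reach adj v w → Reach adj u w

Connected : {n : ℕ} → Adj n → Set
Connected {n} adj = ∀ (u v : Fin n) → Reach adj u v

-- (V1 , complement) is a bipartition: every edge joins V1 with V2 = complement of V1
IsBipartition : {n : ℕ} → Adj n → Subset n → Set
IsBipartition adj V1 = ∀ i j → adj i j ≡ true → lookup V1 i ≢ lookup V1 j

nbhd : {n : ℕ} → Adj n → Subset n → Subset n
nbhd adj A = tabulate (λ v → anyFin (λ u → lookup A u ∧ adj u v))

-- The edge cone ℝ₊𝒜: nonnegative combinations of e_i + e_j over edges {v_i,v_j}.
-- The coefficient λ i j is attached to the (ordered) pair (i , j); coordinate k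
-- collects all pairs with i = k or j = k.
EdgeCone : {n : ℕ} → Adj n → Point n → Set
EdgeCone {n} adj x =
  Σ (Fin n → Fin n → ℚ) λ c →
    (∀ i j → 0ℚ ≤ c i j) ×
    (∀ i j → adj i j ≡ false → c i j ≡ 0ℚ) ×
    (∀ k → x k ≡ sumFin (λ j → c k j) + sumFin (λ i → c i k))

affComb : {n : ℕ} → List (ℚ × Point n) → Point n
affComb [] k = 0ℚ
affComb ((μ , y) ∷ ys) k = μ * y k + affComb ys k

weightSum : {n : ℕ} → List (ℚ × Point n) → ℚ
weightSum [] = 0ℚ
weightSum ((μ , y) ∷ ys) = μ + weightSum ys

Aff : {n : ℕ} → (Point n → Set) → Point n → Set
Aff {n} S x =
  Σ (List (ℚ × Point n)) λ ys →
    All (λ p → S (proj₂ p)) ys × (weightSum ys ≡ 1ℚ) × (∀ k → x k ≡ affComb ys k)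

data HS (n : ℕ) : Set where
  hA : Subset n → HS n
  he : Fin n → HS n

Halfspace : {n : ℕ} → Adj n → HS n → Point n → Set
Halfspace adj (hA A) x = sumOver A x ≤ sumOver (nbhd adj A) x
Halfspace adj (he i) x = 0ℚ ≤ x i

Cut : {n : ℕ} → Adj n → (Point n → Set) → List (HS n) → Point n → Set
Cut adj Q L x = Aff Q x × All (λ h → Halfspace adj h x) L

Represents : {n : ℕ} → Adj n → (Point n → Set) → List (HS n) → Set
Represents adj Q L = ∀ x → Q x ⇔ Cut adj Q L x

IrreducibleRep : {n : ℕ} → Adj n → (Point n → Set) → List (HS n) → Set
IrreducibleRep adj Q L =
  Represents adj Q L × (∀ (k : Fin (length L)) → ¬ Represents adj Q (removeAt L k))

Admissible : {n : ℕ} → Subset n → HS n → Set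
Admissible V1 (hA A) = A ⊂ V1
Admissible V1 (he i) = i ∉ V1

GoodRep : {n : ℕ} → Adj n → Subset n → List (HS n) → Set
GoodRep adj V1 L = IrreducibleRep adj (EdgeCone adj) L × All (Admissible V1) L

-- same halfspaces (as a family; lists are irreducible hence duplicate-free)
SameMembers : {n : ℕ} → List (HS n) → List (HS n) → Set
SameMembers {n} L L' = ∀ (h : HS n) → (h ∈ₗ L) ⇔ (h ∈ₗ L')

module Submission where

-- Write points of ℚ^n in edge coordinates, x = Σ c(i,j) (e_i + e_j): x lies in
-- the edge cone when some such c is nonnegative and in its affine hull for arbitrary c, and a
-- halfspace becomes a linear form on c. Every H_A^- and H_{e_i}^+ is valid on the cone.
--
-- Conversely, let x in the affine hull satisfy H_A^- for all A ⊊ V1 and x_j ≥ 0 for j ∈ V2. For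
-- y with y_i + y_j ≥ 0 on every edge, the function ±y (+ on V1, - on V2) is monotone along edges,
-- and a layer-cake decomposition writes it as a constant plus nonnegative multiples of indicators
-- of sets T closed under taking V1-neighbours of V2-vertices. For such T, Hall's inequality for
-- A = V1 ∖ T gives Σ_{T∩V1} x ≥ Σ_{T∩V2} x, hence y · x ≥ 0, and Farkas' lemma (proved by
-- Fourier–Motzkin elimination) puts x in the cone. So the finite list of all admissible
-- halfspaces represents the cone, and discarding redundant members, i.e. nonnegative
-- combinations of the others, leaves an irreducible representation.
--
-- For uniqueness, each member h of such a list L has a point z on its facet strictly inside the
-- other facets. If L′ is another admissible irreducible representation, h is a nonnegative
-- combination of members of L′; a member g that is positive where h is vanishes at z, so g, as a
-- combination of L, is a positive multiple of h on edge coordinates. On a connected bipartite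
-- graph proportional admissible forms are equal, hence g = h.

open import Data.Bool using (Bool; true; false; _∧_; _∨_; not; if_then_else_)
import Data.Bool as Bool
import Data.Bool.Properties as Boolₚ
open import Data.Empty using (⊥; ⊥-elim)
open import Data.Fin using (Fin; zero; suc; combine; remQuot; _↑ˡ_; _↑ʳ_)
import Data.Fin.Properties as Finₚ
open import Data.Fin.Subset using (Subset; _⊂_; ∣_∣)
import Data.Fin.Subset as S
import Data.Fin.Subset.Properties as Subsetₚ
open import Data.List using (List; []; _∷_; _++_; map; concat; filter; allFin; length; removeAt)
import Data.List as List
open import Data.List.Membership.Propositional using (_∈_; find)
open import Data.List.Membership.Propositional.Properties
open import Data.List.Properties using (++-identityʳ)
open import Data.List.Relation.Binary.Permutation.Propositional using (↭-sym)
open import Data.List.Relation.Binary.Permutation.Propositional.Properties using (shift; All-resp-↭)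
open import Data.List.Relation.Binary.Subset.Propositional using (_⊆_)
import Data.List.Relation.Binary.Subset.Propositional.Properties as ⊆ₚ
open import Data.List.Relation.Unary.All as All using (All; []; _∷_)
import Data.List.Relation.Unary.All.Properties as Allₚ
open import Data.List.Relation.Unary.AllPairs using ([]; _∷_)
open import Data.List.Relation.Unary.Any as Any using (Any; here; there)
import Data.List.Relation.Unary.Any.Properties as Anyₚ
open import Data.List.Relation.Unary.Unique.Propositional using (Unique)
open import Data.Nat using (ℕ; zero; suc)
import Data.Nat as Nat
import Data.Nat.Properties as Natₚ
open import Data.Product using (Σ; ∃; _×_; _,_; proj₁; proj₂)
open import Data.Rational using (ℚ; 0ℚ; 1ℚ; ½; _+_; _*_; -_; _-_; _≤_; _<_; _⊓_; _⊔_; 1/_; positive; nonNegative)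
open import Data.Rational.Base using (≢-nonZero)
open import Data.Rational.Properties
open import Data.Rational.Solver using (module +-*-Solver)
open import Data.Sum using (_⊎_; inj₁; inj₂)
open import Data.Vec using (lookup; tabulate)
import Data.Vec as Vec
import Data.Vec.Properties as Vecₚ
open import Function.Bundles using (_⇔_; mk⇔; Equivalence)
open import Relation.Binary.Definitions using (DecidableEquality; tri<; tri≈; tri>)
open import Relation.Binary.PropositionalEquality
open import Relation.Nullary using (¬_; Dec; yes; no; does)
open import Relation.Nullary.Decidable using (_×-dec_; ¬?)
open import Defs

open +-*-Solver

-- Rational arithmetic and finite sums

0<1 : 0ℚ < 1ℚ
0<1 = positive⁻¹ 1ℚ

0≤1 : 0ℚ ≤ 1ℚ
0≤1 = <⇒≤ 0<1

neg-involutive : ∀ p → - (- p) ≡ p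
neg-involutive = solve 1 (λ p → :- (:- p) := p) refl

0≤-p⇒p≤0 : ∀ {p} → 0ℚ ≤ - p → p ≤ 0ℚ
0≤-p⇒p≤0 {p} h = subst (_≤ 0ℚ) (neg-involutive p) (neg-antimono-≤ h)

-p≤0⇒0≤p : ∀ {p} → - p ≤ 0ℚ → 0ℚ ≤ p
-p≤0⇒0≤p {p} h = subst (0ℚ ≤_) (neg-involutive p) (neg-antimono-≤ h)

-p<0⇒0<p : ∀ {p} → - p < 0ℚ → 0ℚ < p
-p<0⇒0<p {p} h = subst (0ℚ <_) (neg-involutive p) (neg-antimono-< h)

0<-p⇒p<0 : ∀ {p} → 0ℚ < - p → p < 0ℚ
0<-p⇒p<0 {p} h = subst (_< 0ℚ) (neg-involutive p) (neg-antimono-< h)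

p≤q⇒0≤q-p : ∀ {p q} → p ≤ q → 0ℚ ≤ q - p
p≤q⇒0≤q-p {p} {q} h = subst (_≤ q - p) (+-inverseʳ p) (+-monoˡ-≤ (- p) h)

p<q⇒0<q-p : ∀ {p q} → p < q → 0ℚ < q - p
p<q⇒0<q-p {p} {q} h = subst (_< q - p) (+-inverseʳ p) (+-monoˡ-< (- p) h)

0≤q-p⇒p≤q : ∀ {p q} → 0ℚ ≤ q - p → p ≤ q
0≤q-p⇒p≤q {p} {q} h = subst (_≤ q) (+-identityˡ p)
  (subst (0ℚ + p ≤_) (solve 2 (λ p q → (q :- p) :+ p := q) refl p q) (+-monoˡ-≤ p h))

0<q-p⇒p<q : ∀ {p q} → 0ℚ < q - p → p < q
0<q-p⇒p<q {p} {q} h = subst (_< q) (+-identityˡ p)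
  (subst (0ℚ + p <_) (solve 2 (λ p q → (q :- p) :+ p := q) refl p q) (+-monoˡ-< p h))

p≤q⇒p-q≤0 : ∀ {p q} → p ≤ q → p - q ≤ 0ℚ
p≤q⇒p-q≤0 {p} {q} h = 0≤-p⇒p≤0 (subst (0ℚ ≤_) (solve 2 (λ p q → q :- p := :- (p :- q)) refl p q) (p≤q⇒0≤q-p h))

p-q≤0⇒p≤q : ∀ {p q} → p - q ≤ 0ℚ → p ≤ q
p-q≤0⇒p≤q {p} {q} h = 0≤q-p⇒p≤q (subst (0ℚ ≤_) (solve 2 (λ p q → :- (p :- q) := q :- p) refl p q) (neg-antimono-≤ h))

*-nonNeg : ∀ {p q} → 0ℚ ≤ p → 0ℚ ≤ q → 0ℚ ≤ p * q
*-nonNeg {p} {q} hp hq = nonNegative⁻¹ _ {{nonNeg*nonNeg⇒nonNeg p {{nonNegative hp}} q {{nonNegative hq}}}}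

*-pos : ∀ {p q} → 0ℚ < p → 0ℚ < q → 0ℚ < p * q
*-pos {p} {q} hp hq = positive⁻¹ _ {{pos*pos⇒pos p {{positive hp}} q {{positive hq}}}}

*-nonNeg-nonPos : ∀ {p q} → 0ℚ ≤ p → q ≤ 0ℚ → p * q ≤ 0ℚ
*-nonNeg-nonPos {p} {q} hp hq =
  0≤-p⇒p≤0 (subst (0ℚ ≤_) (sym (neg-distribʳ-* p q)) (*-nonNeg hp (neg-antimono-≤ hq)))

*-nonPos-nonNeg : ∀ {p q} → p ≤ 0ℚ → 0ℚ ≤ q → p * q ≤ 0ℚ
*-nonPos-nonNeg {p} {q} hp hq = subst (_≤ 0ℚ) (*-comm q p) (*-nonNeg-nonPos hq hp)

*-pos-neg : ∀ {p q} → 0ℚ < p → q < 0ℚ → p * q < 0ℚ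
*-pos-neg {p} {q} hp hq =
  0<-p⇒p<0 (subst (0ℚ <_) (sym (neg-distribʳ-* p q)) (*-pos hp (neg-antimono-< hq)))

pos⇒≢0 : ∀ {p} → 0ℚ < p → p ≢ 0ℚ
pos⇒≢0 h refl = <-irrefl refl h

neg⇒≢0 : ∀ {p} → p < 0ℚ → p ≢ 0ℚ
neg⇒≢0 h refl = <-irrefl refl h

sign : ∀ p → p < 0ℚ ⊎ p ≡ 0ℚ ⊎ 0ℚ < p
sign p with <-cmp p 0ℚ
... | tri< p<0 _ _ = inj₁ p<0
... | tri≈ _ p≡0 _ = inj₂ (inj₁ p≡0)
... | tri> _ _ p>0 = inj₂ (inj₂ p>0)

pos*q≡0⇒q≡0 : ∀ {p q} → 0ℚ < p → p * q ≡ 0ℚ → q ≡ 0ℚ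
pos*q≡0⇒q≡0 {p} {q} hp e with sign q
... | inj₁ q<0 = ⊥-elim (neg⇒≢0 (*-pos-neg hp q<0) e)
... | inj₂ (inj₁ q≡0) = q≡0
... | inj₂ (inj₂ q>0) = ⊥-elim (pos⇒≢0 (*-pos hp q>0) e)

p*neg≡0⇒p≡0 : ∀ {p q} → q < 0ℚ → p * q ≡ 0ℚ → p ≡ 0ℚ
p*neg≡0⇒p≡0 {p} {q} q<0 e =
  pos*q≡0⇒q≡0 (neg-antimono-< q<0) (trans (solve 2 (λ p q → (:- q) :* p := :- (p :* q)) refl p q) (cong -_ e))

pos*p≤0⇒p≤0 : ∀ {r p} → 0ℚ < r → r * p ≤ 0ℚ → p ≤ 0ℚ
pos*p≤0⇒p≤0 {r} {p} r>0 h with sign p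
... | inj₂ (inj₂ p>0) = ⊥-elim (<-irrefl refl (<-≤-trans (*-pos r>0 p>0) h))
... | inj₂ (inj₁ p≡0) = ≤-reflexive p≡0
... | inj₁ p<0        = <⇒≤ p<0

*-pos-factors : ∀ {p q} → 0ℚ ≤ p → 0ℚ < p * q → 0ℚ < p × 0ℚ < q
*-pos-factors {p} {q} p≥0 pq>0 with sign p | sign q
... | inj₂ (inj₂ p>0) | inj₂ (inj₂ q>0) = p>0 , q>0
... | inj₁ p<0        | _               = ⊥-elim (<-irrefl refl (<-≤-trans p<0 p≥0))
... | inj₂ (inj₁ refl) | _              = ⊥-elim (<-irrefl (sym (*-zeroˡ q)) pq>0)
... | inj₂ (inj₂ p>0) | inj₂ (inj₁ refl) = ⊥-elim (<-irrefl (sym (*-zeroʳ p)) pq>0)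
... | inj₂ (inj₂ p>0) | inj₁ q<0        = ⊥-elim (<-asym pq>0 (*-pos-neg p>0 q<0))

p+q≡0⇒p≡-q : ∀ {p q} → p + q ≡ 0ℚ → p ≡ - q
p+q≡0⇒p≡-q {p} {q} e = begin
  p             ≡⟨ solve 2 (λ p q → p := (p :+ q) :+ (:- q)) refl p q ⟩
  p + q + - q   ≡⟨ cong (_+ - q) e ⟩
  0ℚ + - q      ≡⟨ +-identityˡ (- q) ⟩
  - q           ∎
  where open ≡-Reasoning

p-q≡0⇒p≡q : ∀ {p q} → p - q ≡ 0ℚ → p ≡ q
p-q≡0⇒p≡q {p} {q} e = trans (p+q≡0⇒p≡-q e) (neg-involutive q)

nonPos+nonPos≡0 : ∀ {p q} → p ≤ 0ℚ → q ≤ 0ℚ → p + q ≡ 0ℚ → p ≡ 0ℚ × q ≡ 0ℚ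
nonPos+nonPos≡0 {p} {q} hp hq e =
  ≤-antisym hp (subst (0ℚ ≤_) (sym (p+q≡0⇒p≡-q e)) (neg-antimono-≤ hq)) ,
  ≤-antisym hq (subst (0ℚ ≤_) (sym (p+q≡0⇒p≡-q (trans (+-comm q p) e))) (neg-antimono-≤ hp))

sum-cong : ∀ {n} {f g : Fin n → ℚ} → (∀ i → f i ≡ g i) → sumFin f ≡ sumFin g
sum-cong {zero}  e = refl
sum-cong {suc n} e = cong₂ _+_ (e zero) (sum-cong (λ i → e (suc i)))

sum-zero : ∀ {n} {f : Fin n → ℚ} → (∀ i → f i ≡ 0ℚ) → sumFin f ≡ 0ℚ
sum-zero {zero}  e = refl
sum-zero {suc n} e = trans (cong₂ _+_ (e zero) (sum-zero (λ i → e (suc i)))) (+-identityˡ 0ℚ)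

sum-+ : ∀ {n} (f g : Fin n → ℚ) → sumFin (λ i → f i + g i) ≡ sumFin f + sumFin g
sum-+ {zero}  f g = refl
sum-+ {suc n} f g = trans (cong (f zero + g zero +_) (sum-+ (λ i → f (suc i)) (λ i → g (suc i))))
  (solve 4 (λ a b c d → (a :+ b) :+ (c :+ d) := (a :+ c) :+ (b :+ d)) refl (f zero) (g zero) _ _)

sum-*ˡ : ∀ {n} (a : ℚ) (f : Fin n → ℚ) → sumFin (λ i → a * f i) ≡ a * sumFin f
sum-*ˡ {zero}  a f = sym (*-zeroʳ a)
sum-*ˡ {suc n} a f = trans (cong (a * f zero +_) (sum-*ˡ a (λ i → f (suc i))))
  (sym (*-distribˡ-+ a (f zero) _))

sum-neg : ∀ {n} (f : Fin n → ℚ) → sumFin (λ i → - f i) ≡ - sumFin f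
sum-neg {zero}  f = refl
sum-neg {suc n} f = trans (cong (- f zero +_) (sum-neg (λ i → f (suc i))))
  (sym (neg-distrib-+ (f zero) _))

sum-mono : ∀ {n} {f g : Fin n → ℚ} → (∀ i → f i ≤ g i) → sumFin f ≤ sumFin g
sum-mono {zero}  h = ≤-refl
sum-mono {suc n} h = +-mono-≤ (h zero) (sum-mono (λ i → h (suc i)))

sum-nonPos : ∀ {n} {f : Fin n → ℚ} → (∀ i → f i ≤ 0ℚ) → sumFin f ≤ 0ℚ
sum-nonPos {n} {f} h = subst (sumFin f ≤_) (sum-zero {n} (λ _ → refl)) (sum-mono h)

sum-nonPos≡0 : ∀ {n} {f : Fin n → ℚ} → (∀ i → f i ≤ 0ℚ) → sumFin f ≡ 0ℚ → ∀ i → f i ≡ 0ℚ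
sum-nonPos≡0 {suc n} h e zero = proj₁ (nonPos+nonPos≡0 (h zero) (sum-nonPos (λ i → h (suc i))) e)
sum-nonPos≡0 {suc n} h e (suc i) =
  sum-nonPos≡0 (λ i → h (suc i)) (proj₂ (nonPos+nonPos≡0 (h zero) (sum-nonPos (λ i → h (suc i))) e)) i

sum-swap : ∀ {m n} (f : Fin m → Fin n → ℚ) →
  sumFin (λ i → sumFin (λ j → f i j)) ≡ sumFin (λ j → sumFin (λ i → f i j))
sum-swap {zero}  {n} f = sym (sum-zero {n} (λ _ → refl))
sum-swap {suc m} {n} f = trans (cong (sumFin (f zero) +_) (sum-swap (λ i → f (suc i))))
  (sym (sum-+ (f zero) (λ j → sumFin (λ i → f (suc i) j))))

sum-↑ : ∀ m {n} (f : Fin (m Nat.+ n) → ℚ) →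
  sumFin f ≡ sumFin (λ i → f (i ↑ˡ n)) + sumFin (λ j → f (m ↑ʳ j))
sum-↑ zero    f = sym (+-identityˡ _)
sum-↑ (suc m) f = trans (cong (f zero +_) (sum-↑ m (λ i → f (suc i)))) (sym (+-assoc (f zero) _ _))

sum-combine : ∀ m n (f : Fin (m Nat.* n) → ℚ) →
  sumFin f ≡ sumFin (λ i → sumFin (λ j → f (combine {m} {n} i j)))
sum-combine zero    n f = refl
sum-combine (suc m) n f = trans (sum-↑ n f)
  (cong (sumFin (λ j → f (j ↑ˡ (m Nat.* n))) +_) (sum-combine m n (λ k → f (n ↑ʳ k))))

δ : ∀ {n} → Fin n → Fin n → ℚ
δ k i = if does (k Finₚ.≟ i) then 1ℚ else 0ℚ

δ-same : ∀ {n} (k : Fin n) → δ k k ≡ 1ℚ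
δ-same k with k Finₚ.≟ k
... | yes _   = refl
... | no k≢k = ⊥-elim (k≢k refl)

δ-diff : ∀ {n} {k i : Fin n} → k ≢ i → δ k i ≡ 0ℚ
δ-diff {k = k} {i} k≢i with k Finₚ.≟ i
... | yes k≡i = ⊥-elim (k≢i k≡i)
... | no _    = refl

δ-nonNeg : ∀ {n} (k i : Fin n) → 0ℚ ≤ δ k i
δ-nonNeg k i with k Finₚ.≟ i
... | yes _ = 0≤1
... | no _  = ≤-refl

sum-δ : ∀ {n} (k : Fin n) (f : Fin n → ℚ) → sumFin (λ i → δ k i * f i) ≡ f k
sum-δ {suc n} zero f = begin
  1ℚ * f zero + sumFin (λ i → 0ℚ * f (suc i))
    ≡⟨ cong₂ _+_ (*-identityˡ (f zero)) (sum-zero (λ i → *-zeroˡ (f (suc i)))) ⟩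
  f zero + 0ℚ                                  ≡⟨ +-identityʳ (f zero) ⟩
  f zero                                       ∎
  where open ≡-Reasoning
sum-δ {suc n} (suc k) f =
  trans (cong₂ _+_ (*-zeroˡ (f zero)) (sum-δ k (λ i → f (suc i)))) (+-identityˡ (f (suc k)))

dot : ∀ {n} → (Fin n → ℚ) → (Fin n → ℚ) → ℚ
dot a c = sumFin (λ i → a i * c i)

dot-comm : ∀ {n} (a c : Fin n → ℚ) → dot a c ≡ dot c a
dot-comm a c = sum-cong (λ i → *-comm (a i) (c i))

dot-δʳ : ∀ {n} (a : Fin n → ℚ) (k : Fin n) → dot a (δ k) ≡ a k
dot-δʳ a k = trans (dot-comm a (δ k)) (sum-δ k a)

dot-+ˡ : ∀ {n} (a b c : Fin n → ℚ) → dot (λ i → a i + b i) c ≡ dot a c + dot b c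
dot-+ˡ a b c = trans (sum-cong (λ i → *-distribʳ-+ (c i) (a i) (b i))) (sum-+ (λ i → a i * c i) (λ i → b i * c i))

dot-*ˡ : ∀ {n} (r : ℚ) (a c : Fin n → ℚ) → dot (λ i → r * a i) c ≡ r * dot a c
dot-*ˡ r a c = trans (sum-cong (λ i → *-assoc r (a i) (c i))) (sum-*ˡ r (λ i → a i * c i))

dot-negˡ : ∀ {n} (a c : Fin n → ℚ) → dot (λ i → - a i) c ≡ - dot a c
dot-negˡ a c = trans (sum-cong (λ i → sym (neg-distribˡ-* (a i) (c i)))) (sum-neg (λ i → a i * c i))

dot-diffˡ : ∀ {n} (a b c : Fin n → ℚ) → dot (λ i → a i - b i) c ≡ dot a c - dot b c
dot-diffˡ a b c = trans (dot-+ˡ a (λ i → - b i) c) (cong (dot a c +_) (dot-negˡ b c))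

dot-linearʳ : ∀ {n} (a : Fin n → ℚ) (r s : ℚ) (c d : Fin n → ℚ) →
  dot a (λ i → r * c i + s * d i) ≡ r * dot a c + s * dot a d
dot-linearʳ a r s c d = begin
  dot a (λ i → r * c i + s * d i)
    ≡⟨ dot-comm a _ ⟩
  dot (λ i → r * c i + s * d i) a
    ≡⟨ dot-+ˡ (λ i → r * c i) (λ i → s * d i) a ⟩
  dot (λ i → r * c i) a + dot (λ i → s * d i) a
    ≡⟨ cong₂ _+_ (dot-*ˡ r c a) (dot-*ˡ s d a) ⟩
  r * dot c a + s * dot d a
    ≡⟨ cong₂ (λ u v → r * u + s * v) (dot-comm c a) (dot-comm d a) ⟩
  r * dot a c + s * dot a d ∎
  where open ≡-Reasoning

combination : ∀ {m n} → (Fin m → Fin n → ℚ) → (Fin m → ℚ) → Fin n → ℚ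
combination a c k = sumFin (λ e → c e * a e k)

dot-combination : ∀ {m n} (a : Fin m → Fin n → ℚ) (c : Fin m → ℚ) (f : Fin n → ℚ) →
  dot f (combination a c) ≡ sumFin (λ e → c e * dot (a e) f)
dot-combination a c f = begin
  sumFin (λ k → f k * sumFin (λ e → c e * a e k))
    ≡⟨ sum-cong (λ k → sym (sum-*ˡ (f k) (λ e → c e * a e k))) ⟩
  sumFin (λ k → sumFin (λ e → f k * (c e * a e k)))
    ≡⟨ sum-swap (λ k e → f k * (c e * a e k)) ⟩
  sumFin (λ e → sumFin (λ k → f k * (c e * a e k)))
    ≡⟨ sum-cong (λ e → trans (sum-cong (λ k → solve 3 (λ x y z → x :* (y :* z) := y :* (z :* x)) refl (f k) (c e) (a e k)))
                             (sum-*ˡ (c e) (λ k → a e k * f k))) ⟩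
  sumFin (λ e → c e * dot (a e) f) ∎
  where open ≡-Reasoning

combination-cong : ∀ {m n} (a : Fin m → Fin n → ℚ) {c d : Fin m → ℚ} → (∀ e → c e ≡ d e) →
  ∀ k → combination a c k ≡ combination a d k
combination-cong a c≡d k = sum-cong (λ e → cong (_* a e k) (c≡d e))

combination-linear : ∀ {m n} (a : Fin m → Fin n → ℚ) (r : ℚ) (c d : Fin m → ℚ) →
  ∀ k → combination a (λ e → r * c e + d e) k ≡ r * combination a c k + combination a d k
combination-linear a r c d k = begin
  sumFin (λ e → (r * c e + d e) * a e k)
    ≡⟨ sum-cong (λ e → solve 4 (λ r c d x → (r :* c :+ d) :* x := r :* (c :* x) :+ d :* x) refl r (c e) (d e) (a e k)) ⟩
  sumFin (λ e → r * (c e * a e k) + d e * a e k)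
    ≡⟨ sum-+ (λ e → r * (c e * a e k)) (λ e → d e * a e k) ⟩
  sumFin (λ e → r * (c e * a e k)) + combination a d k
    ≡⟨ cong (_+ combination a d k) (sum-*ˡ r (λ e → c e * a e k)) ⟩
  r * combination a c k + combination a d k ∎
  where open ≡-Reasoning

combination-zero : ∀ {m n} (a : Fin m → Fin n → ℚ) k → combination a (λ _ → 0ℚ) k ≡ 0ℚ
combination-zero a k = sum-zero (λ e → *-zeroˡ (a e k))

combination-*ˡ : ∀ {m n} (a : Fin m → Fin n → ℚ) (r : ℚ) (c : Fin m → ℚ) →
  ∀ k → combination a (λ e → r * c e) k ≡ r * combination a c k
combination-*ˡ a r c k = trans (sum-cong (λ e → *-assoc r (c e) (a e k))) (sum-*ˡ r (λ e → c e * a e k))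

combination-δ : ∀ {m n} (a : Fin m → Fin n → ℚ) (g : Fin m) k → combination a (δ g) k ≡ a g k
combination-δ a g k = sum-δ g (λ e → a e k)

-- Fourier–Motzkin elimination

Cmp : Bool → ℚ → ℚ → Set
Cmp true  = _<_
Cmp false = _≤_

<⇒Cmp : ∀ {s p q} → p < q → Cmp s p q
<⇒Cmp {true}  = λ h → h
<⇒Cmp {false} = <⇒≤

Constraint : ℕ → Set
Constraint m = Bool × (Fin m → ℚ)

Satisfies : ∀ {m} → (Fin m → ℚ) → Constraint m → Set
Satisfies c (s , a) = Cmp s (dot a c) 0ℚ

Feasible : ∀ {m} → List (Constraint m) → Set
Feasible {m} cs = Σ (Fin m → ℚ) λ c → All (Satisfies c) cs

Weighted : ℕ → Set
Weighted m = ℚ × Constraint m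

lincomb : ∀ {m} → List (Weighted m) → Fin m → ℚ
lincomb []                  i = 0ℚ
lincomb ((w , _ , a) ∷ ws) i = w * a i + lincomb ws i

evaluate : ∀ {m} → List (Weighted m) → (Fin m → ℚ) → ℚ
evaluate []                  c = 0ℚ
evaluate ((w , _ , a) ∷ ws) c = w * dot a c + evaluate ws c

WeightedIn : ∀ {m} → List (Constraint m) → Weighted m → Set
WeightedIn cs (w , k) = k ∈ cs × 0ℚ ≤ w

StrictlyWeighted : ∀ {m} → Weighted m → Set
StrictlyWeighted (w , s , _) = s ≡ true × 0ℚ < w

record Certificate {m} (cs : List (Constraint m)) : Set where
  field
    entries : List (Weighted m)
    valid   : All (WeightedIn cs) entries
    cancels : ∀ i → lincomb entries i ≡ 0ℚ
    strict  : Any StrictlyWeighted entries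

dot-lincomb : ∀ {m} (ws : List (Weighted m)) (c : Fin m → ℚ) → dot (lincomb ws) c ≡ evaluate ws c
dot-lincomb []                  c = sum-zero (λ i → *-zeroˡ (c i))
dot-lincomb ((w , s , a) ∷ ws) c = begin
  dot (λ i → w * a i + lincomb ws i) c     ≡⟨ dot-+ˡ (λ i → w * a i) (lincomb ws) c ⟩
  dot (λ i → w * a i) c + dot (lincomb ws) c ≡⟨ cong₂ _+_ (dot-*ˡ w a c) (dot-lincomb ws c) ⟩
  w * dot a c + evaluate ws c               ∎
  where open ≡-Reasoning

evaluate-cancels : ∀ {m} (ws : List (Weighted m)) → (∀ i → lincomb ws i ≡ 0ℚ) → ∀ c → evaluate ws c ≡ 0ℚ
evaluate-cancels ws zero-comb c =
  trans (sym (dot-lincomb ws c)) (sum-zero (λ i → trans (cong (_* c i) (zero-comb i)) (*-zeroˡ (c i))))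

Bound : Set
Bound = Bool × ℚ

argmax : ∀ {A : Set} (f : A → ℚ) (x : A) (xs : List A) → Σ A λ m → m ∈ x ∷ xs × All (λ y → f y ≤ f m) (x ∷ xs)
argmax f x []       = x , here refl , ≤-refl ∷ []
argmax f x (y ∷ xs) with argmax f y xs
... | m , m∈ , ≤m with f x ≤? f m
...   | yes x≤m = m , there m∈ , x≤m ∷ ≤m
...   | no  x≰m = x , here refl , ≤-refl ∷ All.map (λ h → ≤-trans h (<⇒≤ (≰⇒> x≰m))) ≤m

argmin : ∀ {A : Set} (f : A → ℚ) (x : A) (xs : List A) → Σ A λ m → m ∈ x ∷ xs × All (λ y → f m ≤ f y) (x ∷ xs)
argmin f x []       = x , here refl , ≤-refl ∷ []
argmin f x (y ∷ xs) with argmin f y xs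
... | m , m∈ , m≤ with f m ≤? f x
...   | yes m≤x = m , there m∈ , m≤x ∷ m≤
...   | no  m≰x = x , here refl , ≤-refl ∷ All.map (λ h → ≤-trans (<⇒≤ (≰⇒> m≰x)) h) m≤

Compatible : List Bound → List Bound → Set
Compatible ls us = ∀ {l u} → l ∈ ls → u ∈ us → Cmp (proj₁ u ∨ proj₁ l) (proj₂ l) (proj₂ u)

Between : List Bound → List Bound → ℚ → Set
Between ls us t = All (λ l → Cmp (proj₁ l) (proj₂ l) t) ls × All (λ u → Cmp (proj₁ u) t (proj₂ u)) us

p-1<p : ∀ p → p - 1ℚ < p
p-1<p p = 0<q-p⇒p<q (subst (0ℚ <_) (solve 1 (λ p → con 1ℚ := p :- (p :- con 1ℚ)) refl p) 0<1)

p<p+1 : ∀ p → p < p + 1ℚ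
p<p+1 p = 0<q-p⇒p<q (subst (0ℚ <_) (solve 1 (λ p → con 1ℚ := (p :+ con 1ℚ) :- p) refl p) 0<1)

Cmp-∨ˡ : ∀ s t {p q} → Cmp (s ∨ t) p q → Cmp s p q
Cmp-∨ˡ true  t     h = h
Cmp-∨ˡ false true  h = <⇒≤ h
Cmp-∨ˡ false false h = h

Cmp-∨ʳ : ∀ s t {p q} → Cmp (s ∨ t) p q → Cmp t p q
Cmp-∨ʳ true  true  h = h
Cmp-∨ʳ true  false h = <⇒≤ h
Cmp-∨ʳ false t     h = h

½-pos : 0ℚ < ½
½-pos = positive⁻¹ ½

mid : ℚ → ℚ → ℚ
mid p q = ½ * (p + q)

Cmp-mid : ∀ s {v p q} → v ≤ p → Cmp s v q → Cmp s v (mid p q)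
Cmp-mid s {v} {p} {q} v≤p v≺q = go s v≺q
  where
    split : mid p q - v ≡ ½ * (p - v) + ½ * (q - v)
    split = solve 3 (λ v p q → con ½ :* (p :+ q) :- v := con ½ :* (p :- v) :+ con ½ :* (q :- v)) refl v p q
    left : 0ℚ ≤ ½ * (p - v)
    left = *-nonNeg (<⇒≤ ½-pos) (p≤q⇒0≤q-p v≤p)
    go : ∀ s → Cmp s v q → Cmp s v (mid p q)
    go true  v<q = 0<q-p⇒p<q (subst (0ℚ <_) (sym split) (+-mono-≤-< left (*-pos ½-pos (p<q⇒0<q-p v<q))))
    go false v≤q = 0≤q-p⇒p≤q (subst (0ℚ ≤_) (sym split) (+-mono-≤ left (*-nonNeg (<⇒≤ ½-pos) (p≤q⇒0≤q-p v≤q))))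

mid-Cmp : ∀ s {v p q} → Cmp s p v → q ≤ v → Cmp s (mid p q) v
mid-Cmp s {v} {p} {q} p≺v q≤v = go s p≺v
  where
    split : v - mid p q ≡ ½ * (v - p) + ½ * (v - q)
    split = solve 3 (λ v p q → v :- con ½ :* (p :+ q) := con ½ :* (v :- p) :+ con ½ :* (v :- q)) refl v p q
    right : 0ℚ ≤ ½ * (v - q)
    right = *-nonNeg (<⇒≤ ½-pos) (p≤q⇒0≤q-p q≤v)
    go : ∀ s → Cmp s p v → Cmp s (mid p q) v
    go true  p<v = 0<q-p⇒p<q (subst (0ℚ <_) (sym split) (+-mono-<-≤ (*-pos ½-pos (p<q⇒0<q-p p<v)) right))
    go false p≤v = 0≤q-p⇒p≤q (subst (0ℚ ≤_) (sym split) (+-mono-≤ (*-nonNeg (<⇒≤ ½-pos) (p≤q⇒0≤q-p p≤v)) right))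

between : (ls us : List Bound) → Compatible ls us → Σ ℚ (Between ls us)
between []       []       _ = 0ℚ , [] , []
between []       (u ∷ us) _ with argmin proj₂ u us
... | m , _ , m≤ = proj₂ m - 1ℚ , [] , All.map (λ h → <⇒Cmp (<-≤-trans (p-1<p (proj₂ m)) h)) m≤
between (l ∷ ls) []       _ with argmax proj₂ l ls
... | M , _ , ≤M = proj₂ M + 1ℚ , All.map (λ h → <⇒Cmp (≤-<-trans h (p<p+1 (proj₂ M)))) ≤M , []
between (l ∷ ls) (u ∷ us) compat with argmax proj₂ l ls | argmin proj₂ u us
... | M , M∈ , ≤M | m , m∈ , m≤ = mid (proj₂ M) (proj₂ m) , All.tabulate below , All.tabulate above
  where
    below : ∀ {l′} → l′ ∈ l ∷ ls → Cmp (proj₁ l′) (proj₂ l′) (mid (proj₂ M) (proj₂ m))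
    below {s , _} l′∈ = Cmp-mid s (All.lookup ≤M l′∈) (Cmp-∨ʳ (proj₁ m) s (compat l′∈ m∈))
    above : ∀ {u′} → u′ ∈ u ∷ us → Cmp (proj₁ u′) (mid (proj₂ M) (proj₂ m)) (proj₂ u′)
    above {s , _} u′∈ = mid-Cmp s (Cmp-∨ˡ s (proj₁ M) (compat M∈ u′∈)) (All.lookup m≤ u′∈)

lead : ∀ {m} → Constraint (suc m) → ℚ
lead (_ , a) = a zero

tail : ∀ {m} → (Fin (suc m) → ℚ) → Fin m → ℚ
tail a i = a (suc i)

dropLead : ∀ {m} → Constraint (suc m) → Constraint m
dropLead (s , a) = s , tail a

-- 1/p with the junk value inv 0 = 0; it is only ever applied to nonzero leading coefficients.
inv : ℚ → ℚ
inv p with p ≟ 0ℚ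
... | yes _  = 0ℚ
... | no p≢0 = (1/ p) {{≢-nonZero p≢0}}

inv-*-cancel : ∀ {p} → p ≢ 0ℚ → inv p * p ≡ 1ℚ
inv-*-cancel {p} p≢0 with p ≟ 0ℚ
... | yes p≡0 = ⊥-elim (p≢0 p≡0)
... | no p≢0′ = *-inverseˡ p {{≢-nonZero p≢0′}}

inv-pos : ∀ {p} → 0ℚ < p → 0ℚ < inv p
inv-pos {p} p>0 with p ≟ 0ℚ
... | yes p≡0 = ⊥-elim (pos⇒≢0 p>0 p≡0)
... | no _    = positive⁻¹ _ {{1/pos⇒pos p {{positive p>0}}}}

-- The positive combination of p (positive lead) and q (negative lead) that cancels the lead.
cancelLead : ∀ {m} → Constraint (suc m) → Constraint (suc m) → Constraint m
cancelLead (s , a) (s′ , b) = s ∨ s′ , λ i → inv (a zero) * a (suc i) + inv (- b zero) * b (suc i)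

zeros positives negatives : ∀ {m} → List (Constraint (suc m)) → List (Constraint (suc m))
zeros     = filter (λ k → lead k ≟ 0ℚ)
positives = filter (λ k → 0ℚ <? lead k)
negatives = filter (λ k → lead k <? 0ℚ)

pairs : ∀ {m} → List (Constraint (suc m)) → List (Constraint m)
pairs cs = concat (map (λ p → map (cancelLead p) (negatives cs)) (positives cs))

eliminate : ∀ {m} → List (Constraint (suc m)) → List (Constraint m)
eliminate cs = map dropLead (zeros cs) ++ pairs cs

data Origin {m} (cs : List (Constraint (suc m))) : Constraint m → Set where
  unchanged : ∀ z → z ∈ cs → lead z ≡ 0ℚ → Origin cs (dropLead z)
  cancelled : ∀ p q → p ∈ cs → q ∈ cs → 0ℚ < lead p → lead q < 0ℚ → Origin cs (cancelLead p q)

origin : ∀ {m} (cs : List (Constraint (suc m))) {k} → k ∈ eliminate cs → Origin cs k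
origin cs k∈ with ∈-++⁻ (map dropLead (zeros cs)) k∈
... | inj₁ k∈zeros with ∈-map⁻ dropLead k∈zeros
...   | z , z∈ , refl = let z∈cs , z0 = ∈-filter⁻ (λ k → lead k ≟ 0ℚ) z∈ in unchanged z z∈cs z0
origin cs k∈ | inj₂ k∈pairs with ∈-concat⁻′ (map (λ p → map (cancelLead p) (negatives cs)) (positives cs)) k∈pairs
... | ks , k∈ks , ks∈ with ∈-map⁻ (λ p → map (cancelLead p) (negatives cs)) ks∈
...   | p , p∈ , refl with ∈-map⁻ (cancelLead p) k∈ks
...     | q , q∈ , refl =
  let p∈cs , p>0 = ∈-filter⁻ (λ k → 0ℚ <? lead k) p∈
      q∈cs , q<0 = ∈-filter⁻ (λ k → lead k <? 0ℚ) q∈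
  in cancelled p q p∈cs q∈cs p>0 q<0

dropLead∈eliminate : ∀ {m} (cs : List (Constraint (suc m))) {z} → z ∈ cs → lead z ≡ 0ℚ → dropLead z ∈ eliminate cs
dropLead∈eliminate cs z∈ z0 = ∈-++⁺ˡ (∈-map⁺ dropLead (∈-filter⁺ (λ k → lead k ≟ 0ℚ) z∈ z0))

cancelLead∈eliminate : ∀ {m} (cs : List (Constraint (suc m))) {p q} → p ∈ cs → q ∈ cs →
  0ℚ < lead p → lead q < 0ℚ → cancelLead p q ∈ eliminate cs
cancelLead∈eliminate cs {p} {q} p∈ q∈ p>0 q<0 = ∈-++⁺ʳ (map dropLead (zeros cs))
  (∈-concat⁺′ (∈-map⁺ (cancelLead p) (∈-filter⁺ (λ k → lead k <? 0ℚ) q∈ q<0))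
              (∈-map⁺ (λ p → map (cancelLead p) (negatives cs)) (∈-filter⁺ (λ k → 0ℚ <? lead k) p∈ p>0)))

unfold : ∀ {m} {cs : List (Constraint (suc m))} {k} → ℚ → Origin cs k → List (Weighted (suc m))
unfold w (unchanged z _ _)         = (w , z) ∷ []
unfold w (cancelled p q _ _ _ _) = (w * inv (lead p) , p) ∷ (w * inv (- lead q) , q) ∷ []

lincomb-++ : ∀ {m} (ws vs : List (Weighted m)) i → lincomb (ws ++ vs) i ≡ lincomb ws i + lincomb vs i
lincomb-++ []                  vs i = sym (+-identityˡ _)
lincomb-++ ((w , _ , a) ∷ ws) vs i = trans (cong (w * a i +_) (lincomb-++ ws vs i)) (sym (+-assoc (w * a i) _ _))

unfold-lead : ∀ {m} {cs : List (Constraint (suc m))} {k} (w : ℚ) (o : Origin cs k) → lincomb (unfold w o) zero ≡ 0ℚ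
unfold-lead w (unchanged (_ , a) _ z0) =
  trans (cong (λ x → w * x + 0ℚ) z0) (solve 1 (λ w → w :* con 0ℚ :+ con 0ℚ := con 0ℚ) refl w)
unfold-lead w (cancelled (_ , a) (_ , b) _ _ p>0 q<0) = begin
  w * inv (a zero) * a zero + (w * inv (- b zero) * b zero + 0ℚ)
    ≡⟨ solve 5 (λ w x a y b → w :* x :* a :+ (w :* y :* b :+ con 0ℚ) := w :* (x :* a) :- w :* (y :* (:- b))) refl
         w (inv (a zero)) (a zero) (inv (- b zero)) (b zero) ⟩
  w * (inv (a zero) * a zero) - w * (inv (- b zero) * - b zero)
    ≡⟨ cong₂ (λ x y → w * x - w * y) (inv-*-cancel (pos⇒≢0 p>0)) (inv-*-cancel (pos⇒≢0 (neg-antimono-< q<0))) ⟩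
  w * 1ℚ - w * 1ℚ
    ≡⟨ solve 1 (λ w → w :* con 1ℚ :- w :* con 1ℚ := con 0ℚ) refl w ⟩
  0ℚ ∎
  where open ≡-Reasoning

unfold-tail : ∀ {m} {cs : List (Constraint (suc m))} {k} (w : ℚ) (o : Origin cs k) (j : Fin m) →
  lincomb (unfold w o) (suc j) ≡ w * proj₂ k j
unfold-tail w (unchanged _ _ _)                   j = +-identityʳ _
unfold-tail w (cancelled (_ , a) (_ , b) _ _ _ _) j =
  solve 5 (λ w x a y b → w :* x :* a :+ (w :* y :* b :+ con 0ℚ) := w :* (x :* a :+ y :* b)) refl
    w (inv (a zero)) (a (suc j)) (inv (- b zero)) (b (suc j))

unfold-valid : ∀ {m} {cs : List (Constraint (suc m))} {k} {w : ℚ} → 0ℚ ≤ w → (o : Origin cs k) →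
  All (WeightedIn cs) (unfold w o)
unfold-valid w≥0 (unchanged _ z∈ _) = (z∈ , w≥0) ∷ []
unfold-valid w≥0 (cancelled _ _ p∈ q∈ p>0 q<0) =
  (p∈ , *-nonNeg w≥0 (<⇒≤ (inv-pos p>0))) ∷ (q∈ , *-nonNeg w≥0 (<⇒≤ (inv-pos (neg-antimono-< q<0)))) ∷ []

unfold-strict : ∀ {m} {cs : List (Constraint (suc m))} {k} {w : ℚ} → 0ℚ < w → proj₁ k ≡ true →
  (o : Origin cs k) → Any StrictlyWeighted (unfold w o)
unfold-strict w>0 strict (unchanged _ _ _) = here (strict , w>0)
unfold-strict w>0 _ (cancelled (true , _) _ _ _ p>0 _) = here (refl , *-pos w>0 (inv-pos p>0))
unfold-strict w>0 _ (cancelled (false , _) (true , _) _ _ _ q<0) =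
  there (here (refl , *-pos w>0 (inv-pos (neg-antimono-< q<0))))

module _ {m} (cs : List (Constraint (suc m))) where

  unfoldAll : (ws : List (Weighted m)) → All (WeightedIn (eliminate cs)) ws → List (Weighted (suc m))
  unfoldAll []            []               = []
  unfoldAll ((w , _) ∷ ws) ((k∈ , _) ∷ valid) = unfold w (origin cs k∈) ++ unfoldAll ws valid

  unfoldAll-lead : ∀ ws valid → lincomb (unfoldAll ws valid) zero ≡ 0ℚ
  unfoldAll-lead []            []               = refl
  unfoldAll-lead ((w , _) ∷ ws) ((k∈ , _) ∷ valid) = begin
    lincomb (unfold w (origin cs k∈) ++ unfoldAll ws valid) zero
      ≡⟨ lincomb-++ (unfold w (origin cs k∈)) _ zero ⟩
    lincomb (unfold w (origin cs k∈)) zero + lincomb (unfoldAll ws valid) zero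
      ≡⟨ cong₂ _+_ (unfold-lead w (origin cs k∈)) (unfoldAll-lead ws valid) ⟩
    0ℚ ∎
    where open ≡-Reasoning

  unfoldAll-tail : ∀ ws valid (j : Fin m) → lincomb (unfoldAll ws valid) (suc j) ≡ lincomb ws j
  unfoldAll-tail []            []               j = refl
  unfoldAll-tail ((w , _) ∷ ws) ((k∈ , _) ∷ valid) j =
    trans (lincomb-++ (unfold w (origin cs k∈)) _ (suc j))
          (cong₂ _+_ (unfold-tail w (origin cs k∈) j) (unfoldAll-tail ws valid j))

  unfoldAll-valid : ∀ ws valid → All (WeightedIn cs) (unfoldAll ws valid)
  unfoldAll-valid []            []                 = []
  unfoldAll-valid ((w , _) ∷ ws) ((k∈ , w≥0) ∷ valid) =
    Allₚ.++⁺ (unfold-valid w≥0 (origin cs k∈)) (unfoldAll-valid ws valid)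

  unfoldAll-strict : ∀ ws valid → Any StrictlyWeighted ws → Any StrictlyWeighted (unfoldAll ws valid)
  unfoldAll-strict ((w , _) ∷ ws) ((k∈ , _) ∷ valid) (here (strict , w>0)) =
    Anyₚ.++⁺ˡ (unfold-strict w>0 strict (origin cs k∈))
  unfoldAll-strict ((w , _) ∷ ws) ((k∈ , _) ∷ valid) (there s) =
    Anyₚ.++⁺ʳ (unfold w (origin cs k∈)) (unfoldAll-strict ws valid s)

  liftCertificate : Certificate (eliminate cs) → Certificate cs
  liftCertificate cert = record
    { entries = unfoldAll entries valid
    ; valid   = unfoldAll-valid entries valid
    ; cancels = λ { zero → unfoldAll-lead entries valid ; (suc j) → trans (unfoldAll-tail entries valid j) (cancels j) }
    ; strict  = unfoldAll-strict entries valid strict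
    }
    where open Certificate cert

Cmp-shift : ∀ s {p q} → Cmp s (p + q) 0ℚ → Cmp s q (- p)
Cmp-shift s {p} {q} h = go s h
  where
    eq : - (p + q) ≡ - p - q
    eq = solve 2 (λ p q → :- (p :+ q) := :- p :- q) refl p q
    go : ∀ s → Cmp s (p + q) 0ℚ → Cmp s q (- p)
    go true  h = 0<q-p⇒p<q (subst (0ℚ <_) eq (neg-antimono-< h))
    go false h = 0≤q-p⇒p≤q (subst (0ℚ ≤_) eq (neg-antimono-≤ h))

Cmp-diff : ∀ s {p q} → Cmp s p q → Cmp s (p - q) 0ℚ
Cmp-diff s {p} {q} h = go s h
  where
    eq : q - p ≡ - (p - q)
    eq = solve 2 (λ p q → q :- p := :- (p :- q)) refl p q
    go : ∀ s → Cmp s p q → Cmp s (p - q) 0ℚ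
    go true  h = 0<-p⇒p<0 (subst (0ℚ <_) eq (p<q⇒0<q-p h))
    go false h = 0≤-p⇒p≤0 (subst (0ℚ ≤_) eq (p≤q⇒0≤q-p h))

Cmp-*pos : ∀ s {r p} → 0ℚ < r → Cmp s p 0ℚ → Cmp s (r * p) 0ℚ
Cmp-*pos true  r>0 h = *-pos-neg r>0 h
Cmp-*pos false r>0 h = *-nonNeg-nonPos (<⇒≤ r>0) h

below-upper⇒satisfied : ∀ s {l t X} → 0ℚ < l → Cmp s t (- (inv l * X)) → Cmp s (l * t + X) 0ℚ
below-upper⇒satisfied s {l} {t} {X} l>0 t≺u = subst (λ v → Cmp s v 0ℚ) eq (Cmp-*pos s l>0 (Cmp-diff s t≺u))
  where
    eq : l * (t - - (inv l * X)) ≡ l * t + X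
    eq = begin
      l * (t - - (inv l * X)) ≡⟨ solve 4 (λ l t i X → l :* (t :- (:- (i :* X))) := l :* t :+ (i :* l) :* X) refl l t (inv l) X ⟩
      l * t + inv l * l * X   ≡⟨ cong (λ u → l * t + u * X) (inv-*-cancel (pos⇒≢0 l>0)) ⟩
      l * t + 1ℚ * X          ≡⟨ cong (l * t +_) (*-identityˡ X) ⟩
      l * t + X               ∎
      where open ≡-Reasoning

above-lower⇒satisfied : ∀ s {l t X} → l < 0ℚ → Cmp s (inv (- l) * X) t → Cmp s (l * t + X) 0ℚ
above-lower⇒satisfied s {l} {t} {X} l<0 b≺t = subst (λ v → Cmp s v 0ℚ) eq (Cmp-*pos s (neg-antimono-< l<0) (Cmp-diff s b≺t))
  where
    eq : - l * (inv (- l) * X - t) ≡ l * t + X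
    eq = begin
      - l * (inv (- l) * X - t)
        ≡⟨ solve 4 (λ l t i X → (:- l) :* (i :* X :- t) := l :* t :+ (i :* (:- l)) :* X) refl l t (inv (- l)) X ⟩
      l * t + inv (- l) * - l * X ≡⟨ cong (λ u → l * t + u * X) (inv-*-cancel (pos⇒≢0 (neg-antimono-< l<0))) ⟩
      l * t + 1ℚ * X              ≡⟨ cong (l * t +_) (*-identityˡ X) ⟩
      l * t + X                   ∎
      where open ≡-Reasoning

extend : ∀ {m} → ℚ → (Fin m → ℚ) → Fin (suc m) → ℚ
extend t c zero    = t
extend t c (suc i) = c i

module _ {m} (cs : List (Constraint (suc m))) (c : Fin m → ℚ) where

  restValue : Constraint (suc m) → ℚ
  restValue (_ , a) = dot (tail a) c

  -- Read off a constraint as a bound on the eliminated variable t: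
  -- lead · t + restValue ≺ 0 bounds t above when lead > 0 and below when lead < 0.
  lowerBound upperBound : Constraint (suc m) → Bound
  lowerBound k = proj₁ k , inv (- lead k) * restValue k
  upperBound k = proj₁ k , - (inv (lead k) * restValue k)

  lowers uppers : List Bound
  lowers = map lowerBound (negatives cs)
  uppers = map upperBound (positives cs)

  module _ (sat : All (Satisfies c) (eliminate cs)) where

    bounds-compatible : Compatible lowers uppers
    bounds-compatible l∈ u∈ with ∈-map⁻ lowerBound l∈ | ∈-map⁻ upperBound u∈
    ... | q , q∈ , refl | p , p∈ , refl =
      let p∈cs , p>0 = ∈-filter⁻ (λ k → 0ℚ <? lead k) p∈
          q∈cs , q<0 = ∈-filter⁻ (λ k → lead k <? 0ℚ) q∈
          a = proj₂ p ; b = proj₂ q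
      in Cmp-shift (proj₁ p ∨ proj₁ q)
           (subst (λ v → Cmp (proj₁ p ∨ proj₁ q) v 0ℚ)
             (trans (dot-+ˡ (λ i → inv (a zero) * a (suc i)) (λ i → inv (- b zero) * b (suc i)) c)
                    (cong₂ _+_ (dot-*ˡ (inv (a zero)) (tail a) c) (dot-*ˡ (inv (- b zero)) (tail b) c)))
             (All.lookup sat (cancelLead∈eliminate cs p∈cs q∈cs p>0 q<0)))

    t : ℚ
    t = proj₁ (between lowers uppers bounds-compatible)

    extend-satisfies : ∀ {k} → k ∈ cs → Satisfies (extend t c) k
    extend-satisfies {s , a} k∈ with sign (a zero)
    ... | inj₂ (inj₁ lead≡0) = subst (λ v → Cmp s v 0ℚ)
      (sym (trans (cong (λ l → l * t + restValue (s , a)) lead≡0) (trans (cong (_+ restValue (s , a)) (*-zeroˡ t)) (+-identityˡ _))))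
      (All.lookup sat (dropLead∈eliminate cs k∈ lead≡0))
    ... | inj₂ (inj₂ lead>0) = below-upper⇒satisfied s lead>0
      (All.lookup (proj₂ (proj₂ (between lowers uppers bounds-compatible)))
        (∈-map⁺ upperBound (∈-filter⁺ (λ k → 0ℚ <? lead k) k∈ lead>0)))
    ... | inj₁ lead<0 = above-lower⇒satisfied s lead<0
      (All.lookup (proj₁ (proj₂ (between lowers uppers bounds-compatible)))
        (∈-map⁺ lowerBound (∈-filter⁺ (λ k → lead k <? 0ℚ) k∈ lead<0)))

liftSolution : ∀ {m} (cs : List (Constraint (suc m))) → Feasible (eliminate cs) → Feasible cs
liftSolution cs (c , sat) = extend (t cs c sat) c , All.tabulate (extend-satisfies cs c sat)

feasible⊎certificate : ∀ {m} (cs : List (Constraint m)) → Feasible cs ⊎ Certificate cs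
feasible⊎certificate {zero} cs with Any.any? (λ k → proj₁ k Bool.≟ true) cs
... | yes has-strict =
  let (s , a) , k∈ , strict = find has-strict
  in inj₂ (record { entries = (1ℚ , s , a) ∷ [] ; valid = (k∈ , 0≤1) ∷ [] ; cancels = λ () ; strict = here (strict , 0<1) })
... | no no-strict = inj₁ ((λ ()) , All.tabulate satisfied)
  where
    satisfied : ∀ {k} → k ∈ cs → Satisfies (λ ()) k
    satisfied {true , a}  k∈ = ⊥-elim (no-strict (Any.map (λ { refl → refl }) k∈))
    satisfied {false , a} k∈ = ≤-refl
feasible⊎certificate {suc m} cs with feasible⊎certificate (eliminate cs)
... | inj₁ feasible = inj₁ (liftSolution cs feasible)
... | inj₂ cert     = inj₂ (liftCertificate cs cert)

-- Farkas' lemma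

module _ {I : Set} {m} (F : I → Fin m → ℚ) where

  term : ℚ × I → (Fin m → ℚ) → ℚ
  term (w , g) c = w * dot (F g) c

  weightedSum : List (ℚ × I) → (Fin m → ℚ) → ℚ
  weightedSum []       c = 0ℚ
  weightedSum (t ∷ ts) c = term t c + weightedSum ts c

  Witness : List I → (Fin m → ℚ) → Set
  Witness M b = Σ (Fin m → ℚ) λ c → (∀ g → g ∈ M → dot (F g) c ≤ 0ℚ) × 0ℚ < dot b c

  record Combination (M : List I) (b : Fin m → ℚ) : Set where
    field
      scale    : ℚ
      scale>0  : 0ℚ < scale
      terms    : List (ℚ × I)
      terms∈   : All (λ t → proj₂ t ∈ M × 0ℚ ≤ proj₁ t) terms
      identity : ∀ c → scale * dot b c ≡ weightedSum terms c

  weightedSum-nonPos : ∀ {c} ts → All (λ t → term t c ≤ 0ℚ) ts → weightedSum ts c ≤ 0ℚ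
  weightedSum-nonPos []       []           = ≤-refl
  weightedSum-nonPos (_ ∷ ts) (t≤0 ∷ ts≤0) = +-mono-≤ t≤0 (weightedSum-nonPos ts ts≤0)

  weightedSum-nonPos≡0 : ∀ {c} ts → All (λ t → term t c ≤ 0ℚ) ts → weightedSum ts c ≡ 0ℚ →
    All (λ t → term t c ≡ 0ℚ) ts
  weightedSum-nonPos≡0 []       []           _ = []
  weightedSum-nonPos≡0 (_ ∷ ts) (t≤0 ∷ ts≤0) e =
    let t≡0 , ts≡0 = nonPos+nonPos≡0 t≤0 (weightedSum-nonPos ts ts≤0) e in t≡0 ∷ weightedSum-nonPos≡0 ts ts≤0 ts≡0

  weightedSum-pos : ∀ {c} ts → All (λ t → 0ℚ ≤ proj₁ t) ts → 0ℚ < weightedSum ts c →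
    Any (λ t → 0ℚ < proj₁ t × 0ℚ < dot (F (proj₂ t)) c) ts
  weightedSum-pos [] [] sum>0 = ⊥-elim (<-irrefl refl sum>0)
  weightedSum-pos {c} ((w , g) ∷ ts) (w≥0 ∷ ts≥0) sum>0 with 0ℚ <? w * dot (F g) c
  ... | yes t>0 = here (*-pos-factors w≥0 t>0)
  ... | no t≯0  = there (weightedSum-pos ts ts≥0
    (subst (0ℚ <_) (solve 2 (λ t s → t :+ s :- t := s) refl (w * dot (F g) c) (weightedSum ts c))
      (+-mono-<-≤ sum>0 (neg-antimono-≤ (≮⇒≥ t≯0)))))

  totalWeight : List (ℚ × I) → ℚ
  totalWeight []             = 0ℚ
  totalWeight ((w , _) ∷ ts) = w + totalWeight ts

  totalWeight-nonNeg : ∀ ts → All (λ t → 0ℚ ≤ proj₁ t) ts → 0ℚ ≤ totalWeight ts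
  totalWeight-nonNeg []       []           = ≤-refl
  totalWeight-nonNeg (_ ∷ ts) (w≥0 ∷ ts≥0) = +-mono-≤ w≥0 (totalWeight-nonNeg ts ts≥0)

  weightedSum-collapse : ∀ {c} b ts → All (λ t → term t c ≡ proj₁ t * dot b c) ts →
    weightedSum ts c ≡ totalWeight ts * dot b c
  weightedSum-collapse {c} b []             []           = sym (*-zeroˡ (dot b c))
  weightedSum-collapse {c} b ((w , _) ∷ ts) (t≡ ∷ ts≡) =
    trans (cong₂ _+_ t≡ (weightedSum-collapse b ts ts≡)) (sym (*-distribʳ-+ (dot b c) w (totalWeight ts)))

  combination-implies : ∀ {M b c} → Combination M b → (∀ g → g ∈ M → dot (F g) c ≤ 0ℚ) → dot b c ≤ 0ℚ
  combination-implies {c = c} comb sat =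
    pos*p≤0⇒p≤0 scale>0 (subst (_≤ 0ℚ) (sym (identity c))
      (weightedSum-nonPos terms (All.map (λ { (g∈ , w≥0) → *-nonNeg-nonPos w≥0 (sat _ g∈) }) terms∈)))
    where open Combination comb

  module _ (M : List I) (b : Fin m → ℚ) where

    system : List (Constraint m)
    system = (true , λ i → - b i) ∷ map (λ g → false , F g) M

    feasible⇒witness : Feasible system → Witness M b
    feasible⇒witness (c , -b<0 ∷ sat) =
      c , (λ g g∈ → All.lookup (Allₚ.map⁻ sat) g∈) , -p<0⇒0<p (subst (_< 0ℚ) (dot-negˡ b c) -b<0)

    strictWeight : (ws : List (Weighted m)) → All (WeightedIn system) ws → ℚ
    strictWeight []            []                          = 0ℚ
    strictWeight ((w , _) ∷ ws) ((here refl , _) ∷ valid)  = w + strictWeight ws valid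
    strictWeight ((w , _) ∷ ws) ((there _ , _) ∷ valid)    = strictWeight ws valid

    otherTerms : (ws : List (Weighted m)) → All (WeightedIn system) ws → List (ℚ × I)
    otherTerms []            []                          = []
    otherTerms ((w , _) ∷ ws) ((here refl , _) ∷ valid)  = otherTerms ws valid
    otherTerms ((w , _) ∷ ws) ((there k∈ , _) ∷ valid)   = (w , proj₁ (∈-map⁻ _ k∈)) ∷ otherTerms ws valid

    otherTerms∈ : ∀ ws valid → All (λ t → proj₂ t ∈ M × 0ℚ ≤ proj₁ t) (otherTerms ws valid)
    otherTerms∈ []            []                            = []
    otherTerms∈ ((w , _) ∷ ws) ((here refl , _) ∷ valid)    = otherTerms∈ ws valid
    otherTerms∈ ((w , _) ∷ ws) ((there k∈ , w≥0) ∷ valid)   =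
      (proj₁ (proj₂ (∈-map⁻ _ k∈)) , w≥0) ∷ otherTerms∈ ws valid

    strictWeight-nonNeg : ∀ ws valid → 0ℚ ≤ strictWeight ws valid
    strictWeight-nonNeg []            []                          = ≤-refl
    strictWeight-nonNeg ((w , _) ∷ ws) ((here refl , w≥0) ∷ valid) = +-mono-≤ w≥0 (strictWeight-nonNeg ws valid)
    strictWeight-nonNeg ((w , _) ∷ ws) ((there _ , _) ∷ valid)     = strictWeight-nonNeg ws valid

    strictWeight-pos : ∀ ws valid → Any StrictlyWeighted ws → 0ℚ < strictWeight ws valid
    strictWeight-pos ((w , _) ∷ ws) ((here refl , _) ∷ valid) (here (_ , w>0)) =
      +-mono-<-≤ w>0 (strictWeight-nonNeg ws valid)
    strictWeight-pos ((w , _) ∷ ws) ((there k∈ , _) ∷ valid) (here (s≡true , _)) with ∈-map⁻ _ k∈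
    ... | _ , _ , refl with s≡true
    ...   | ()
    strictWeight-pos ((w , _) ∷ ws) ((here refl , w≥0) ∷ valid) (there s) =
      +-mono-≤-< w≥0 (strictWeight-pos ws valid s)
    strictWeight-pos ((w , _) ∷ ws) ((there _ , _) ∷ valid) (there s) = strictWeight-pos ws valid s

    evaluate-split : ∀ ws valid c →
      evaluate ws c ≡ weightedSum (otherTerms ws valid) c - strictWeight ws valid * dot b c
    evaluate-split []            []                          c = solve 1 (λ B → con 0ℚ := con 0ℚ :- con 0ℚ :* B) refl (dot b c)
    evaluate-split ((w , _) ∷ ws) ((here refl , _) ∷ valid)  c =
      trans (cong₂ _+_ (trans (cong (w *_) (dot-negˡ b c)) (sym (neg-distribʳ-* w (dot b c)))) (evaluate-split ws valid c))
            (solve 4 (λ w B S T → :- (w :* B) :+ (T :- S :* B) := T :- (w :+ S) :* B) refl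
               w (dot b c) (strictWeight ws valid) (weightedSum (otherTerms ws valid) c))
    evaluate-split ((w , _) ∷ ws) ((there k∈ , _) ∷ valid)   c with ∈-map⁻ _ k∈
    ... | g , _ , refl =
      trans (cong (w * dot (F g) c +_) (evaluate-split ws valid c))
            (sym (+-assoc (w * dot (F g) c) _ _))

    -- The strict entries of a certificate all carry -b; their total weight becomes the scale.
    certificate⇒combination : Certificate system → Combination M b
    certificate⇒combination cert = record
      { scale    = strictWeight entries valid
      ; scale>0  = strictWeight-pos entries valid strict
      ; terms    = otherTerms entries valid
      ; terms∈   = otherTerms∈ entries valid
      ; identity = λ c → sym (p-q≡0⇒p≡q (trans (sym (evaluate-split entries valid c)) (evaluate-cancels entries cancels c)))
      }
      where open Certificate cert

  witness⊎combination : ∀ M b → Witness M b ⊎ Combination M b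
  witness⊎combination M b with feasible⊎certificate (system M b)
  ... | inj₁ feasible = inj₁ (feasible⇒witness M b feasible)
  ... | inj₂ cert     = inj₂ (certificate⇒combination M b cert)

aggregate : ∀ {m} → List (ℚ × Fin m) → Fin m → ℚ
aggregate []             e = 0ℚ
aggregate ((w , g) ∷ ts) e = w * δ g e + aggregate ts e

aggregate-nonNeg : ∀ {m} {P : Fin m → Set} (ts : List (ℚ × Fin m)) →
  All (λ t → P (proj₂ t) × 0ℚ ≤ proj₁ t) ts → ∀ e → 0ℚ ≤ aggregate ts e
aggregate-nonNeg []       []               e = ≤-refl
aggregate-nonNeg ((_ , g) ∷ ts) ((_ , w≥0) ∷ ts≥0) e = +-mono-≤ (*-nonNeg w≥0 (δ-nonNeg g e)) (aggregate-nonNeg ts ts≥0 e)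

combination-aggregate : ∀ {m n} (a : Fin m → Fin n → ℚ) (ts : List (ℚ × Fin m)) k →
  combination a (aggregate ts) k ≡ weightedSum a ts (δ k)
combination-aggregate a []             k = combination-zero a k
combination-aggregate a ((w , g) ∷ ts) k = begin
  combination a (λ e → w * δ g e + aggregate ts e) k
    ≡⟨ combination-linear a w (δ g) (aggregate ts) k ⟩
  w * combination a (δ g) k + combination a (aggregate ts) k
    ≡⟨ cong₂ (λ u v → w * u + v) (trans (combination-δ a g k) (sym (dot-δʳ (a g) k))) (combination-aggregate a ts k) ⟩
  w * dot (a g) (δ k) + weightedSum a ts (δ k) ∎
  where open ≡-Reasoning

farkas : ∀ {m n} (a : Fin m → Fin n → ℚ) (x : Fin n → ℚ) →
  (Σ (Fin m → ℚ) λ c → (∀ e → 0ℚ ≤ c e) × (∀ k → x k ≡ combination a c k)) ⊎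
  (Σ (Fin n → ℚ) λ y → (∀ e → dot (a e) y ≤ 0ℚ) × 0ℚ < dot x y)
farkas {m} a x with witness⊎combination a (allFin m) x
... | inj₁ (y , a·y≤0 , x·y>0) = inj₂ (y , (λ e → a·y≤0 e (∈-allFin e)) , x·y>0)
... | inj₂ comb = inj₁ (c , c≥0 , x≡)
  where
    open Combination comb
    c : Fin m → ℚ
    c e = inv scale * aggregate terms e
    c≥0 : ∀ e → 0ℚ ≤ c e
    c≥0 e = *-nonNeg (<⇒≤ (inv-pos scale>0)) (aggregate-nonNeg terms terms∈ e)
    x≡ : ∀ k → x k ≡ combination a c k
    x≡ k = begin
      x k                                        ≡⟨ sym (*-identityˡ (x k)) ⟩
      1ℚ * x k                                   ≡⟨ cong (_* x k) (sym (inv-*-cancel (pos⇒≢0 scale>0))) ⟩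
      inv scale * scale * x k                    ≡⟨ *-assoc (inv scale) scale (x k) ⟩
      inv scale * (scale * x k)                  ≡⟨ cong (λ u → inv scale * (scale * u)) (sym (dot-δʳ x k)) ⟩
      inv scale * (scale * dot x (δ k))          ≡⟨ cong (inv scale *_) (identity (δ k)) ⟩
      inv scale * weightedSum a terms (δ k)      ≡⟨ cong (inv scale *_) (sym (combination-aggregate a terms k)) ⟩
      inv scale * combination a (aggregate terms) k ≡⟨ sym (combination-*ˡ a (inv scale) (aggregate terms) k) ⟩
      combination a c k                          ∎
      where open ≡-Reasoning

-- Edge coordinates

ind : Bool → ℚ
ind b = if b then 1ℚ else 0ℚ

ind-nonNeg : ∀ b → 0ℚ ≤ ind b
ind-nonNeg true  = 0≤1
ind-nonNeg false = ≤-refl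

ind-mono : ∀ {a b} → (a ≡ true → b ≡ true) → ind a ≤ ind b
ind-mono {false} {b}     _   = ind-nonNeg b
ind-mono {true}  {true}  _   = ≤-refl
ind-mono {true}  {false} a⇒b with a⇒b refl
... | ()

ind-*-nonPos : ∀ b {p} → (b ≡ true → p ≤ 0ℚ) → ind b * p ≤ 0ℚ
ind-*-nonPos true  {p} h = subst (_≤ 0ℚ) (sym (*-identityˡ p)) (h refl)
ind-*-nonPos false {p} _ = ≤-reflexive (*-zeroˡ p)

ind-*-zero : ∀ b {p} → (b ≡ true → p ≡ 0ℚ) → ind b * p ≡ 0ℚ
ind-*-zero true  {p} h = trans (*-identityˡ p) (h refl)
ind-*-zero false {p} _ = *-zeroˡ p

if-ind : ∀ b y → (if b then y else 0ℚ) ≡ ind b * y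
if-ind true  y = sym (*-identityˡ y)
if-ind false y = sym (*-zeroˡ y)

anyFin-true : ∀ {m} (f : Fin m → Bool) u → f u ≡ true → anyFin f ≡ true
anyFin-true f zero    fu = cong (_∨ anyFin (λ i → f (suc i))) fu
anyFin-true f (suc u) fu with f zero
... | true  = refl
... | false = anyFin-true (λ i → f (suc i)) u fu

anyFin-witness : ∀ {m} (f : Fin m → Bool) → anyFin f ≡ true → ∃ λ u → f u ≡ true
anyFin-witness {suc m} f any with f zero in f0
... | true  = zero , f0
... | false = let u , fu = anyFin-witness (λ i → f (suc i)) any in suc u , fu

∧-true : ∀ {a b} → a ∧ b ≡ true → a ≡ true × b ≡ true
∧-true {true} {true} _ = refl , refl

lookup⇒∈ : ∀ {n} {A : Subset n} {v} → lookup A v ≡ true → v S.∈ A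
lookup⇒∈ {A = A} {v} = Vecₚ.lookup⇒[]= v A

∈⇒lookup : ∀ {n} {A : Subset n} {v} → v S.∈ A → lookup A v ≡ true
∈⇒lookup = Vecₚ.[]=⇒lookup

∉⇒lookup : ∀ {n} {A : Subset n} {v} → v S.∉ A → lookup A v ≡ false
∉⇒lookup v∉A = Boolₚ.¬-not (λ v∈A → v∉A (lookup⇒∈ v∈A))

true≢false : true ≢ false
true≢false ()

δ-sym : ∀ {n} (i k : Fin n) → δ i k ≡ δ k i
δ-sym i k with i Finₚ.≟ k | k Finₚ.≟ i
... | yes _   | yes _   = refl
... | no _    | no _    = refl
... | yes i≡k | no k≢i  = ⊥-elim (k≢i (sym i≡k))
... | no i≢k  | yes k≡i = ⊥-elim (i≢k (sym k≡i))

∈-Aff : ∀ {n} {S : Point n → Set} {x} → S x → Aff S x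
∈-Aff {x = x} x∈S = (1ℚ , x) ∷ [] , x∈S ∷ [] , +-identityʳ 1ℚ , λ k → sym (trans (+-identityʳ _) (*-identityˡ (x k)))

module EdgeSpace {n : ℕ} (adj : Adj n) where

  -- One coordinate per ordered pair of vertices; pairs that are not edges get a zero column.
  Pairs : ℕ
  Pairs = n Nat.* n

  pair : Fin n → Fin n → Fin Pairs
  pair = combine

  ends : Fin Pairs → Fin n × Fin n
  ends = remQuot n

  ends-pair : ∀ i j → ends (pair i j) ≡ (i , j)
  ends-pair = Finₚ.remQuot-combine

  isEdge : Fin n → Fin n → ℚ
  isEdge i j = ind (adj i j)

  incidence : Fin Pairs → Point n
  incidence e k = isEdge (proj₁ (ends e)) (proj₂ (ends e)) * (δ (proj₁ (ends e)) k + δ (proj₂ (ends e)) k)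

  boundary : (Fin Pairs → ℚ) → Point n
  boundary = combination incidence

  pullback : Point n → Fin Pairs → ℚ
  pullback f e = dot (incidence e) f

  pullback-ends : ∀ f e → pullback f e ≡ isEdge (proj₁ (ends e)) (proj₂ (ends e)) * (f (proj₁ (ends e)) + f (proj₂ (ends e)))
  pullback-ends f e = let (i , j) = ends e in begin
    dot (λ k → isEdge i j * (δ i k + δ j k)) f ≡⟨ dot-*ˡ (isEdge i j) (λ k → δ i k + δ j k) f ⟩
    isEdge i j * dot (λ k → δ i k + δ j k) f   ≡⟨ cong (isEdge i j *_) (dot-+ˡ (δ i) (δ j) f) ⟩
    isEdge i j * (dot (δ i) f + dot (δ j) f)   ≡⟨ cong (isEdge i j *_) (cong₂ _+_ (sum-δ i f) (sum-δ j f)) ⟩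
    isEdge i j * (f i + f j)                   ∎
    where open ≡-Reasoning

  pullback-pair : ∀ f i j → adj i j ≡ true → pullback f (pair i j) ≡ f i + f j
  pullback-pair f i j ij = begin
    pullback f (pair i j)
      ≡⟨ pullback-ends f (pair i j) ⟩
    isEdge _ _ * (f (proj₁ (ends (pair i j))) + f (proj₂ (ends (pair i j))))
      ≡⟨ cong (λ p → isEdge (proj₁ p) (proj₂ p) * (f (proj₁ p) + f (proj₂ p))) (ends-pair i j) ⟩
    ind (adj i j) * (f i + f j)
      ≡⟨ cong (λ b → ind b * (f i + f j)) ij ⟩
    1ℚ * (f i + f j)
      ≡⟨ *-identityˡ (f i + f j) ⟩
    f i + f j ∎
    where open ≡-Reasoning

  dot-pullback : ∀ f c → dot (pullback f) c ≡ dot f (boundary c)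
  dot-pullback f c = trans (sum-cong (λ e → *-comm (pullback f e) (c e))) (sym (dot-combination incidence c f))

  boundary-expand : ∀ c k → boundary c k ≡
    sumFin (λ j → isEdge k j * c (pair k j)) + sumFin (λ i → isEdge i k * c (pair i k))
  boundary-expand c k = begin
    sumFin (λ e → c e * incidence e k)
      ≡⟨ sum-combine n n (λ e → c e * incidence e k) ⟩
    sumFin (λ i → sumFin (λ j → c (pair i j) * incidence (pair i j) k))
      ≡⟨ sum-cong (λ i → sum-cong (λ j → summand i j)) ⟩
    sumFin (λ i → sumFin (λ j → δ k i * g i j + δ k j * g i j))
      ≡⟨ sum-cong (λ i → sum-+ (λ j → δ k i * g i j) (λ j → δ k j * g i j)) ⟩
    sumFin (λ i → sumFin (λ j → δ k i * g i j) + sumFin (λ j → δ k j * g i j))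
      ≡⟨ sum-+ (λ i → sumFin (λ j → δ k i * g i j)) (λ i → sumFin (λ j → δ k j * g i j)) ⟩
    sumFin (λ i → sumFin (λ j → δ k i * g i j)) + sumFin (λ i → sumFin (λ j → δ k j * g i j))
      ≡⟨ cong₂ _+_ (trans (sum-cong (λ i → sum-*ˡ (δ k i) (g i))) (sum-δ k (λ i → sumFin (g i))))
                   (sum-cong (λ i → sum-δ k (g i))) ⟩
    sumFin (g k) + sumFin (λ i → g i k) ∎
    where
      open ≡-Reasoning
      g : Fin n → Fin n → ℚ
      g i j = isEdge i j * c (pair i j)
      summand : ∀ i j → c (pair i j) * incidence (pair i j) k ≡ δ k i * g i j + δ k j * g i j
      summand i j = begin
        c (pair i j) * incidence (pair i j) k
          ≡⟨ cong (λ p → c (pair i j) * (isEdge (proj₁ p) (proj₂ p) * (δ (proj₁ p) k + δ (proj₂ p) k))) (ends-pair i j) ⟩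
        c (pair i j) * (isEdge i j * (δ i k + δ j k))
          ≡⟨ cong₂ (λ u v → c (pair i j) * (isEdge i j * (u + v))) (δ-sym i k) (δ-sym j k) ⟩
        c (pair i j) * (isEdge i j * (δ k i + δ k j))
          ≡⟨ solve 4 (λ c m a b → c :* (m :* (a :+ b)) := a :* (m :* c) :+ b :* (m :* c)) refl
               (c (pair i j)) (isEdge i j) (δ k i) (δ k j) ⟩
        δ k i * g i j + δ k j * g i j ∎

  isEdge-absorbs : ∀ (C : Fin n → Fin n → ℚ) → (∀ i j → adj i j ≡ false → C i j ≡ 0ℚ) →
    ∀ i j → isEdge i j * C i j ≡ C i j
  isEdge-absorbs C C-off i j with adj i j in ij
  ... | true  = *-identityˡ (C i j)
  ... | false = trans (*-zeroˡ (C i j)) (sym (C-off i j ij))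

  edgeCone⇒boundary : ∀ {x} → EdgeCone adj x →
    Σ (Fin Pairs → ℚ) λ c → (∀ e → 0ℚ ≤ c e) × (∀ k → x k ≡ boundary c k)
  edgeCone⇒boundary {x} (C , C≥0 , C-off , x≡) = c , (λ e → C≥0 _ _) , λ k → trans (x≡ k) (sym (trans (boundary-expand c k)
      (cong₂ _+_ (sum-cong (λ j → trans (cong (isEdge k j *_) (c-pair k j)) (isEdge-absorbs C C-off k j)))
                 (sum-cong (λ i → trans (cong (isEdge i k *_) (c-pair i k)) (isEdge-absorbs C C-off i k))))))
    where
      c : Fin Pairs → ℚ
      c e = C (proj₁ (ends e)) (proj₂ (ends e))
      c-pair : ∀ i j → c (pair i j) ≡ C i j
      c-pair i j = cong (λ p → C (proj₁ p) (proj₂ p)) (ends-pair i j)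

  boundary⇒edgeCone : ∀ c → (∀ e → 0ℚ ≤ c e) → EdgeCone adj (boundary c)
  boundary⇒edgeCone c c≥0 =
    (λ i j → isEdge i j * c (pair i j)) ,
    (λ i j → *-nonNeg (ind-nonNeg (adj i j)) (c≥0 (pair i j))) ,
    (λ i j ij → trans (cong (λ b → ind b * c (pair i j)) ij) (*-zeroˡ (c (pair i j)))) ,
    boundary-expand c

  aff⇒boundary : ∀ {x} → Aff (EdgeCone adj) x → Σ (Fin Pairs → ℚ) λ c → ∀ k → x k ≡ boundary c k
  aff⇒boundary (ys , ys∈ , _ , x≡) = let c , c≡ = go ys ys∈ in c , λ k → trans (x≡ k) (c≡ k)
    where
      go : ∀ ys → All (λ p → EdgeCone adj (proj₂ p)) ys → Σ (Fin Pairs → ℚ) λ c → ∀ k → affComb ys k ≡ boundary c k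
      go []             []          = (λ _ → 0ℚ) , λ k → sym (combination-zero incidence k)
      go ((μ , y) ∷ ys) (y∈ ∷ ys∈) =
        let c₁ , _ , y≡ = edgeCone⇒boundary y∈
            c₂ , ys≡    = go ys ys∈
        in (λ e → μ * c₁ e + c₂ e) ,
           λ k → trans (cong₂ _+_ (cong (μ *_) (y≡ k)) (ys≡ k)) (sym (combination-linear incidence μ c₁ c₂ k))

  positivePart : ℚ → ℚ
  positivePart r with 0ℚ ≤? r
  ... | yes _ = r
  ... | no _  = 0ℚ

  positivePart-nonNeg : ∀ r → 0ℚ ≤ positivePart r
  positivePart-nonNeg r with 0ℚ ≤? r
  ... | yes r≥0 = r≥0
  ... | no _    = ≤-refl

  positivePart-split : ∀ r → r ≡ 1ℚ * positivePart r + (- 1ℚ * positivePart (- r) + 0ℚ)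
  positivePart-split r with 0ℚ ≤? r | 0ℚ ≤? - r
  ... | yes r≥0 | yes -r≥0 rewrite ≤-antisym (0≤-p⇒p≤0 -r≥0) r≥0 = refl
  ... | yes _   | no _     = solve 1 (λ r → r := con 1ℚ :* r :+ (con (- 1ℚ) :* con 0ℚ :+ con 0ℚ)) refl r
  ... | no _    | yes _    = solve 1 (λ r → r := con 1ℚ :* con 0ℚ :+ (con (- 1ℚ) :* (:- r) :+ con 0ℚ)) refl r
  ... | no r≱0  | no -r≱0  = ⊥-elim (r≱0 (-p≤0⇒0≤p (<⇒≤ (≰⇒> -r≱0))))

  boundary⇒aff : ∀ c → Aff (EdgeCone adj) (boundary c)
  boundary⇒aff c =
    (1ℚ , boundary c⁺) ∷ (- 1ℚ , boundary c⁻) ∷ (1ℚ , boundary (λ _ → 0ℚ)) ∷ [] ,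
    boundary⇒edgeCone c⁺ (λ e → positivePart-nonNeg (c e)) ∷ boundary⇒edgeCone c⁻ (λ e → positivePart-nonNeg (- c e)) ∷
      boundary⇒edgeCone (λ _ → 0ℚ) (λ _ → ≤-refl) ∷ [] ,
    refl ,
    λ k → begin
      boundary c k
        ≡⟨ combination-cong incidence (λ e → positivePart-split (c e)) k ⟩
      boundary (λ e → 1ℚ * c⁺ e + (- 1ℚ * c⁻ e + 0ℚ)) k
        ≡⟨ combination-linear incidence 1ℚ c⁺ _ k ⟩
      1ℚ * boundary c⁺ k + boundary (λ e → - 1ℚ * c⁻ e + 0ℚ) k
        ≡⟨ cong (1ℚ * boundary c⁺ k +_) (combination-linear incidence (- 1ℚ) c⁻ (λ _ → 0ℚ) k) ⟩
      1ℚ * boundary c⁺ k + (- 1ℚ * boundary c⁻ k + boundary (λ _ → 0ℚ) k)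
        ≡⟨ cong (λ u → 1ℚ * boundary c⁺ k + (- 1ℚ * boundary c⁻ k + u)) (sym (trans (+-identityʳ _) (*-identityˡ _))) ⟩
      1ℚ * boundary c⁺ k + (- 1ℚ * boundary c⁻ k + (1ℚ * boundary (λ _ → 0ℚ) k + 0ℚ)) ∎
    where
      open ≡-Reasoning
      c⁺ c⁻ : Fin Pairs → ℚ
      c⁺ e = positivePart (c e)
      c⁻ e = positivePart (- c e)

  lookup-nbhd : ∀ A v → lookup (nbhd adj A) v ≡ anyFin (λ u → lookup A u ∧ adj u v)
  lookup-nbhd A v = Vecₚ.lookup∘tabulate (λ v → anyFin (λ u → lookup A u ∧ adj u v)) v

  adjacent⇒∈nbhd : ∀ A {u v} → lookup A u ≡ true → adj u v ≡ true → lookup (nbhd adj A) v ≡ true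
  adjacent⇒∈nbhd A {u} {v} u∈A uv = trans (lookup-nbhd A v) (anyFin-true _ u (cong₂ _∧_ u∈A uv))

  ∈nbhd⇒adjacent : ∀ A {v} → lookup (nbhd adj A) v ≡ true → ∃ λ u → lookup A u ≡ true × adj u v ≡ true
  ∈nbhd⇒adjacent A {v} v∈N = let u , p = anyFin-witness _ (trans (sym (lookup-nbhd A v)) v∈N) in u , ∧-true p

  form : HS n → Point n
  form (hA A) v = ind (lookup A v) - ind (lookup (nbhd adj A) v)
  form (he i) v = - δ i v

  edgeForm : HS n → Fin Pairs → ℚ
  edgeForm h = pullback (form h)

  sumOver-dot : ∀ (A : Subset n) x → sumOver A x ≡ dot (λ v → ind (lookup A v)) x
  sumOver-dot A x = sum-cong (λ v → if-ind (lookup A v) (x v))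

  dot-form : ∀ h x → Halfspace adj h x ⇔ (dot (form h) x ≤ 0ℚ)
  dot-form (hA A) x = mk⇔ (λ h → subst (_≤ 0ℚ) (sym eq) (p≤q⇒p-q≤0 h)) (λ h → p-q≤0⇒p≤q (subst (_≤ 0ℚ) eq h))
    where
      eq : dot (form (hA A)) x ≡ sumOver A x - sumOver (nbhd adj A) x
      eq = trans (dot-diffˡ (λ v → ind (lookup A v)) (λ v → ind (lookup (nbhd adj A) v)) x)
        (sym (cong₂ _-_ (sumOver-dot A x) (sumOver-dot (nbhd adj A) x)))
  dot-form (he i) x = mk⇔ (λ h → subst (_≤ 0ℚ) (sym eq) (neg-antimono-≤ h)) (λ h → -p≤0⇒0≤p (subst (_≤ 0ℚ) eq h))
    where
      eq : dot (form (he i)) x ≡ - x i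
      eq = trans (dot-negˡ (δ i) x) (cong -_ (sum-δ i x))

  halfspace-resp : ∀ h {x y} → (∀ k → x k ≡ y k) → Halfspace adj h y → Halfspace adj h x
  halfspace-resp h {x} {y} x≡y hy = Equivalence.from (dot-form h x)
    (subst (_≤ 0ℚ) (sum-cong (λ k → cong (form h k *_) (sym (x≡y k)))) (Equivalence.to (dot-form h y) hy))

  halfspace⇔edgeForm : ∀ h c → Halfspace adj h (boundary c) ⇔ (dot (edgeForm h) c ≤ 0ℚ)
  halfspace⇔edgeForm h c = mk⇔
    (λ hc → subst (_≤ 0ℚ) (sym (dot-pullback (form h) c)) (Equivalence.to (dot-form h (boundary c)) hc))
    (λ hc → Equivalence.from (dot-form h (boundary c)) (subst (_≤ 0ℚ) (dot-pullback (form h) c) hc))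

  module _ (simple : IsSimple adj) where

    -- Every halfspace H_A^- is valid, whatever A is: an edge with an end in A has its other end in N(A).
    form-edge : ∀ h {i j} → adj i j ≡ true → form h i + form h j ≤ 0ℚ
    form-edge (hA A) {i} {j} ij = subst (_≤ 0ℚ) regroup
      (+-mono-≤ (p≤q⇒p-q≤0 (ind-mono (λ i∈A → adjacent⇒∈nbhd A i∈A ij)))
                (p≤q⇒p-q≤0 (ind-mono (λ j∈A → adjacent⇒∈nbhd A j∈A (trans (proj₁ simple j i) ij)))))
      where
        regroup = solve 4 (λ a b c d → (a :- d) :+ (b :- c) := (a :- c) :+ (b :- d)) refl
          (ind (lookup A i)) (ind (lookup A j)) (ind (lookup (nbhd adj A) i)) (ind (lookup (nbhd adj A) j))
    form-edge (he k) {i} {j} _ =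
      subst (_≤ 0ℚ) (neg-distrib-+ (δ k i) (δ k j)) (neg-antimono-≤ (+-mono-≤ (δ-nonNeg k i) (δ-nonNeg k j)))

    edgeForm-nonPos : ∀ h e → edgeForm h e ≤ 0ℚ
    edgeForm-nonPos h e = subst (_≤ 0ℚ) (sym (pullback-ends (form h) e)) (ind-*-nonPos (adj _ _) (form-edge h))

    edgeForm-nonNeg-nonPos : ∀ h c → (∀ e → 0ℚ ≤ c e) → dot (edgeForm h) c ≤ 0ℚ
    edgeForm-nonNeg-nonPos h c c≥0 = sum-nonPos (λ e → *-nonPos-nonNeg (edgeForm-nonPos h e) (c≥0 e))

    halfspace-valid : ∀ h {x} → EdgeCone adj x → Halfspace adj h x
    halfspace-valid h x∈ = let c , c≥0 , x≡ = edgeCone⇒boundary x∈ in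
      halfspace-resp h x≡ (Equivalence.from (halfspace⇔edgeForm h c) (edgeForm-nonNeg-nonPos h c c≥0))

-- Hall's inequalities

_<ᵇ_ : ℚ → ℚ → Bool
p <ᵇ q with p <? q
... | yes _ = true
... | no _  = false

<ᵇ⇒< : ∀ {p q} → p <ᵇ q ≡ true → p < q
<ᵇ⇒< {p} {q} h with p <? q
... | yes p<q = p<q

≮ᵇ⇒≥ : ∀ {p q} → p <ᵇ q ≡ false → q ≤ p
≮ᵇ⇒≥ {p} {q} h with p <? q
... | no p≮q = ≮⇒≥ p≮q

<⇒<ᵇ : ∀ {p q} → p < q → p <ᵇ q ≡ true
<⇒<ᵇ {p} {q} p<q with p <? q
... | yes _   = refl
... | no p≮q = ⊥-elim (p≮q p<q)

maxFin : ∀ {m} → (Fin m → ℚ) → ℚ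
maxFin {zero}  f = 0ℚ
maxFin {suc m} f = f zero ⊔ maxFin (λ i → f (suc i))

≤-maxFin : ∀ {m} (f : Fin m → ℚ) v → f v ≤ maxFin f
≤-maxFin f zero    = p≤p⊔q (f zero) _
≤-maxFin f (suc v) = ≤-trans (≤-maxFin (λ i → f (suc i)) v) (p≤q⊔p (f zero) _)

p⊓q<q⇒p<q : ∀ {p q} → p ⊓ q < q → p < q
p⊓q<q⇒p<q {p} {q} h with p <? q
... | yes p<q = p<q
... | no p≮q = ⊥-elim (<-irrefl (p≥q⇒p⊓q≡q (≮⇒≥ p≮q)) h)

module HallInequalities {n} (adj : Adj n) (V1 : Subset n) (simple : IsSimple adj) (bip : IsBipartition adj V1)
  (x : Point n) (c₀ : Fin (n Nat.* n) → ℚ) (x≡ : ∀ k → x k ≡ EdgeSpace.boundary adj c₀ k)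
  (hall : ∀ A → A ⊂ V1 → Halfspace adj (hA A) x)
  (V2-nonNeg : ∀ j → j S.∉ V1 → Halfspace adj (he j) x) where

  open EdgeSpace adj

  side : Fin n → Bool
  side v = lookup V1 v

  sgn : Bool → ℚ
  sgn true  = 1ℚ
  sgn false = - 1ℚ

  σ : Point n
  σ v = sgn (side v)

  sgn-opposite : ∀ {a b} → a ≢ b → sgn a + sgn b ≡ 0ℚ
  sgn-opposite {true}  {true}  a≢b = ⊥-elim (a≢b refl)
  sgn-opposite {true}  {false} _   = refl
  sgn-opposite {false} {true}  _   = refl
  sgn-opposite {false} {false} a≢b = ⊥-elim (a≢b refl)

  -- Every edge joins the two sides, so the boundary of anything is balanced between them.
  dot-σ : dot σ x ≡ 0ℚ
  dot-σ = begin
    dot σ x            ≡⟨ sum-cong (λ k → cong (σ k *_) (x≡ k)) ⟩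
    dot σ (boundary c₀) ≡⟨ sym (dot-pullback σ c₀) ⟩
    dot (pullback σ) c₀ ≡⟨ sum-zero (λ e → trans (cong (_* c₀ e) (pullback-σ e)) (*-zeroˡ (c₀ e))) ⟩
    0ℚ                 ∎
    where
      open ≡-Reasoning
      pullback-σ : ∀ e → pullback σ e ≡ 0ℚ
      pullback-σ e = trans (pullback-ends σ e) (ind-*-zero (adj _ _) (λ ij → sgn-opposite (bip _ _ ij)))

  isolated⇒0 : ∀ v → (∀ j → adj v j ≡ false) → x v ≡ 0ℚ
  isolated⇒0 v no-edge = begin
    x v ≡⟨ trans (x≡ v) (boundary-expand c₀ v) ⟩
    sumFin (λ j → isEdge v j * c₀ (pair v j)) + sumFin (λ i → isEdge i v * c₀ (pair i v))
      ≡⟨ cong₂ _+_ (sum-zero (λ j → ind-*-zero (adj v j) (λ vj → ⊥-elim (true≢false (trans (sym vj) (no-edge j))))))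
                   (sum-zero (λ i → ind-*-zero (adj i v)
                     (λ iv → ⊥-elim (true≢false (trans (sym iv) (trans (proj₁ simple i v) (no-edge i))))))) ⟩
    0ℚ ∎
    where open ≡-Reasoning

  Φ : Point n → ℚ
  Φ f = dot (λ v → σ v * f v) x

  Φ-const : ∀ M → Φ (λ _ → M) ≡ 0ℚ
  Φ-const M = begin
    dot (λ v → σ v * M) x ≡⟨ sum-cong (λ v → solve 3 (λ s m y → s :* m :* y := m :* (s :* y)) refl (σ v) M (x v)) ⟩
    sumFin (λ v → M * (σ v * x v)) ≡⟨ sum-*ˡ M (λ v → σ v * x v) ⟩
    M * dot σ x ≡⟨ cong (M *_) dot-σ ⟩
    M * 0ℚ ≡⟨ *-zeroʳ M ⟩
    0ℚ ∎
    where open ≡-Reasoning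

  Φ-+* : ∀ f r g → Φ (λ v → f v + r * g v) ≡ Φ f + r * Φ g
  Φ-+* f r g = begin
    dot (λ v → σ v * (f v + r * g v)) x
      ≡⟨ sum-cong (λ v → solve 5 (λ s a r b y → s :* (a :+ r :* b) :* y := s :* a :* y :+ r :* (s :* b :* y)) refl
                            (σ v) (f v) r (g v) (x v)) ⟩
    sumFin (λ v → σ v * f v * x v + r * (σ v * g v * x v))
      ≡⟨ sum-+ (λ v → σ v * f v * x v) (λ v → r * (σ v * g v * x v)) ⟩
    Φ f + sumFin (λ v → r * (σ v * g v * x v))
      ≡⟨ cong (Φ f +_) (sum-*ˡ r (λ v → σ v * g v * x v)) ⟩
    Φ f + r * Φ g ∎
    where open ≡-Reasoning

  UpClosed : (Fin n → Bool) → Set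
  UpClosed T = ∀ i j → adj i j ≡ true → side i ≡ true → T j ≡ true → T i ≡ true

  σ-split : ∀ a b → sgn a * ind b ≡ sgn a - ind (a ∧ not b) + ind (not a ∧ not b)
  σ-split true  true  = refl
  σ-split true  false = refl
  σ-split false true  = refl
  σ-split false false = refl

  V2∖T-nonNeg : ∀ (T : Fin n → Bool) v → 0ℚ ≤ ind (not (side v) ∧ not (T v)) * x v
  V2∖T-nonNeg T v with side v in sv
  ... | true  = ≤-reflexive (sym (*-zeroˡ (x v)))
  ... | false = *-nonNeg (ind-nonNeg (not (T v))) (V2-nonNeg v (λ v∈ → true≢false (trans (sym (∈⇒lookup v∈)) sv)))

  -- With A = V1 ∖ T, Hall's inequality for A and N(A) ⊆ V2 ∖ T give Φ(T) = Σ_{V2∖T} x - Σ_A x ≥ 0.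
  module MeetingV1 (T : Fin n → Bool) (up : UpClosed T) (i₀ : Fin n) (i₀∈V1 : side i₀ ≡ true) (i₀∈T : T i₀ ≡ true) where

    A : Subset n
    A = tabulate (λ v → side v ∧ not (T v))

    lookup-A : ∀ v → lookup A v ≡ side v ∧ not (T v)
    lookup-A = Vecₚ.lookup∘tabulate (λ v → side v ∧ not (T v))

    A⊂V1 : A ⊂ V1
    A⊂V1 = (λ v∈A → lookup⇒∈ (proj₁ (∧-true (trans (sym (lookup-A _)) (∈⇒lookup v∈A))))) ,
           i₀ , lookup⇒∈ i₀∈V1 ,
           λ i₀∈A → true≢false (trans (sym (proj₂ (∧-true (trans (sym (lookup-A i₀)) (∈⇒lookup i₀∈A)))))
                                      (cong not i₀∈T))

    N⊆V2∖T : ∀ v → lookup (nbhd adj A) v ≡ true → not (side v) ∧ not (T v) ≡ true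
    N⊆V2∖T v v∈N with ∈nbhd⇒adjacent A v∈N
    ... | u , u∈A , uv with ∧-true (trans (sym (lookup-A u)) u∈A)
    ...   | u∈V1 , u∉T with side v in sv | T v in tv
    ...     | true  | _     = ⊥-elim (bip u v uv (trans u∈V1 (sym sv)))
    ...     | false | true  = ⊥-elim (true≢false (trans (sym u∉T) (cong not (up u v uv u∈V1 tv))))
    ...     | false | false = refl

    ΣA ΣN ΣV2∖T : ℚ
    ΣA    = dot (λ v → ind (lookup A v)) x
    ΣN    = dot (λ v → ind (lookup (nbhd adj A) v)) x
    ΣV2∖T = dot (λ v → ind (not (side v) ∧ not (T v))) x

    ΣN≤ΣV2∖T : ΣN ≤ ΣV2∖T
    ΣN≤ΣV2∖T = sum-mono pointwise
      where
        pointwise : ∀ v → ind (lookup (nbhd adj A) v) * x v ≤ ind (not (side v) ∧ not (T v)) * x v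
        pointwise v with lookup (nbhd adj A) v in v∈N
        ... | true  = ≤-reflexive (cong (λ b → ind b * x v) (sym (N⊆V2∖T v v∈N)))
        ... | false = subst (_≤ ind (not (side v) ∧ not (T v)) * x v) (sym (*-zeroˡ (x v))) (V2∖T-nonNeg T v)

    Φ-split : Φ (λ v → ind (T v)) ≡ ΣV2∖T - ΣA
    Φ-split = begin
      Φ (λ v → ind (T v))
        ≡⟨ sum-cong (λ v → cong (_* x v) (trans (σ-split (side v) (T v))
                                               (cong (λ b → σ v - ind b + ind (not (side v) ∧ not (T v))) (sym (lookup-A v))))) ⟩
      dot (λ v → σ v - ind (lookup A v) + ind (not (side v) ∧ not (T v))) x
        ≡⟨ dot-+ˡ (λ v → σ v - ind (lookup A v)) (λ v → ind (not (side v) ∧ not (T v))) x ⟩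
      dot (λ v → σ v - ind (lookup A v)) x + ΣV2∖T
        ≡⟨ cong (_+ ΣV2∖T) (dot-diffˡ σ (λ v → ind (lookup A v)) x) ⟩
      dot σ x - ΣA + ΣV2∖T
        ≡⟨ cong (λ s → s - ΣA + ΣV2∖T) dot-σ ⟩
      0ℚ - ΣA + ΣV2∖T
        ≡⟨ solve 2 (λ a r → con 0ℚ :- a :+ r := r :- a) refl ΣA ΣV2∖T ⟩
      ΣV2∖T - ΣA ∎
      where open ≡-Reasoning

    Φ-nonNeg : 0ℚ ≤ Φ (λ v → ind (T v))
    Φ-nonNeg = subst (0ℚ ≤_) (sym Φ-split)
      (p≤q⇒0≤q-p (≤-trans (subst₂ _≤_ (sumOver-dot A x) (sumOver-dot (nbhd adj A) x) (hall A A⊂V1)) ΣN≤ΣV2∖T))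

  -- A set T avoiding V1 consists of isolated vertices, on which x vanishes.
  Φ-upClosed-avoiding-V1 : ∀ T → UpClosed T → (∀ v → side v ≡ true → T v ≡ false) → Φ (λ v → ind (T v)) ≡ 0ℚ
  Φ-upClosed-avoiding-V1 T up avoids = sum-zero summand
    where
      summand : ∀ v → σ v * ind (T v) * x v ≡ 0ℚ
      summand v with T v in tv
      ... | false = solve 2 (λ s y → s :* con 0ℚ :* y := con 0ℚ) refl (σ v) (x v)
      ... | true  = trans (cong (σ v * 1ℚ *_) (isolated⇒0 v no-edge)) (*-zeroʳ (σ v * 1ℚ))
        where
          v∈V2 : side v ≡ false
          v∈V2 with side v in sv
          ... | true  = ⊥-elim (true≢false (trans (sym tv) (avoids v sv)))
          ... | false = refl
          no-edge : ∀ j → adj v j ≡ false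
          no-edge j with adj v j in vj
          ... | false = refl
          ... | true with side j in sj
          ...   | false = ⊥-elim (bip v j vj (trans v∈V2 (sym sj)))
          ...   | true  = ⊥-elim (true≢false (trans (sym (up j v (trans (proj₁ simple j v) vj) sj tv)) (avoids j sj)))

  Φ-upClosed : ∀ T → UpClosed T → 0ℚ ≤ Φ (λ v → ind (T v))
  Φ-upClosed T up with Finₚ.any? (λ v → (side v Bool.≟ true) ×-dec (T v Bool.≟ true))
  ... | yes (i₀ , i₀∈V1 , i₀∈T) = MeetingV1.Φ-nonNeg T up i₀ i₀∈V1 i₀∈T
  ... | no avoids = ≤-reflexive (sym (Φ-upClosed-avoiding-V1 T up λ v sv → Boolₚ.¬-not (λ tv → avoids (v , sv , tv))))

  Φ-cong : ∀ {f g} → (∀ v → f v ≡ g v) → Φ f ≡ Φ g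
  Φ-cong f≡g = sum-cong (λ v → cong (λ u → σ v * u * x v) (f≡g v))

  Monotone : Point n → Set
  Monotone f = ∀ i j → adj i j ≡ true → side i ≡ true → f j ≤ f i

  below : Point n → ℚ → Subset n
  below f M = tabulate (λ v → f v <ᵇ M)

  lookup-below : ∀ f M v → lookup (below f M) v ≡ f v <ᵇ M
  lookup-below f M = Vecₚ.lookup∘tabulate (λ v → f v <ᵇ M)

  -- Lower the top level M of f to the next level M′; the difference is (M - M′) times an up-closed set.
  module LayerStep (f : Point n) (M : ℚ) (mono : Monotone f) (f≤M : ∀ v → f v ≤ M) (w₀ : Fin n) (fw₀<M : f w₀ < M) where

    candidates : List (Fin n)
    candidates = filter (λ v → f v <? M) (allFin n)

    best = argmax f w₀ candidates

    v₁ : Fin n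
    v₁ = proj₁ best

    M′ : ℚ
    M′ = f v₁

    candidate<M : ∀ {v} → v ∈ w₀ ∷ candidates → f v < M
    candidate<M (here refl) = fw₀<M
    candidate<M (there v∈)  = proj₂ (∈-filter⁻ (λ v → f v <? M) {xs = allFin n} v∈)

    M′<M : M′ < M
    M′<M = candidate<M (proj₁ (proj₂ best))

    <M⇒≤M′ : ∀ v → f v < M → f v ≤ M′
    <M⇒≤M′ v fv<M = All.lookup (proj₂ (proj₂ best)) (there (∈-filter⁺ (λ v → f v <? M) (∈-allFin v) fv<M))

    f′ : Point n
    f′ v = f v ⊓ M′

    top : Fin n → Bool
    top v = not (f v <ᵇ M)

    f-split : ∀ v → f v ≡ f′ v + (M - M′) * ind (top v)
    f-split v with f v <ᵇ M in fv<M
    ... | true  = begin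
      f v                       ≡⟨ sym (p≤q⇒p⊓q≡p (<M⇒≤M′ v (<ᵇ⇒< fv<M))) ⟩
      f′ v                      ≡⟨ solve 3 (λ a m m′ → a := a :+ (m :- m′) :* con 0ℚ) refl (f′ v) M M′ ⟩
      f′ v + (M - M′) * 0ℚ      ∎
      where open ≡-Reasoning
    ... | false = begin
      f v                       ≡⟨ fv≡M ⟩
      M                         ≡⟨ solve 2 (λ m m′ → m := m′ :+ (m :- m′) :* con 1ℚ) refl M M′ ⟩
      M′ + (M - M′) * 1ℚ
        ≡⟨ cong (λ u → u + (M - M′) * 1ℚ) (sym (p≥q⇒p⊓q≡q (subst (M′ ≤_) (sym fv≡M) (<⇒≤ M′<M)))) ⟩
      f′ v + (M - M′) * 1ℚ      ∎
      where
        open ≡-Reasoning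
        fv≡M : f v ≡ M
        fv≡M = ≤-antisym (f≤M v) (≮ᵇ⇒≥ fv<M)

    Φ-split : Φ f ≡ Φ f′ + (M - M′) * Φ (λ v → ind (top v))
    Φ-split = trans (Φ-cong f-split) (Φ-+* f′ (M - M′) (λ v → ind (top v)))

    f′-monotone : Monotone f′
    f′-monotone i j ij si = ⊓-monoˡ-≤ M′ (mono i j ij si)

    f′≤M′ : ∀ v → f′ v ≤ M′
    f′≤M′ v = p⊓q≤q (f v) M′

    top-upClosed : UpClosed top
    top-upClosed i j ij si tj with f j <ᵇ M in fj<M | f i <ᵇ M in fi<M
    ... | false | false = refl
    ... | false | true  = ⊥-elim (<-irrefl refl (≤-<-trans (≤-trans (≮ᵇ⇒≥ fj<M) (mono i j ij si)) (<ᵇ⇒< fi<M)))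

    below-shrinks : below f′ M′ ⊂ below f M
    below-shrinks =
      (λ {v} v∈ → lookup⇒∈ (trans (lookup-below f M v)
        (<⇒<ᵇ (<-trans (p⊓q<q⇒p<q (<ᵇ⇒< (trans (sym (lookup-below f′ M′ v)) (∈⇒lookup v∈)))) M′<M)))) ,
      v₁ , lookup⇒∈ (trans (lookup-below f M v₁) (<⇒<ᵇ M′<M)) ,
      λ v₁∈ → <-irrefl (⊓-idem M′) (<ᵇ⇒< (trans (sym (lookup-below f′ M′ v₁)) (∈⇒lookup v₁∈)))

  Φ-monotone : ∀ k f M → Monotone f → (∀ v → f v ≤ M) → ∣ below f M ∣ Nat.< k → 0ℚ ≤ Φ f
  Φ-monotone (suc k) f M mono f≤M size with Finₚ.any? (λ v → f v <? M)
  ... | no none =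
    ≤-reflexive (sym (trans (Φ-cong (λ v → ≤-antisym (f≤M v) (≮⇒≥ (λ fv<M → none (v , fv<M))))) (Φ-const M)))
  ... | yes (w₀ , fw₀<M) = subst (0ℚ ≤_) (sym Φ-split)
    (+-mono-≤ (Φ-monotone k f′ M′ f′-monotone f′≤M′
                 (Natₚ.<-≤-trans (Subsetₚ.p⊂q⇒∣p∣<∣q∣ below-shrinks) (Natₚ.≤-pred size)))
              (*-nonNeg (<⇒≤ (p<q⇒0<q-p M′<M)) (Φ-upClosed top top-upClosed)))
    where open LayerStep f M mono f≤M w₀ fw₀<M

  hall⇒dual-nonNeg : ∀ y → (∀ i j → adj i j ≡ true → 0ℚ ≤ y i + y j) → 0ℚ ≤ dot y x
  hall⇒dual-nonNeg y y-edge = subst (0ℚ ≤_) Φf≡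
    (Φ-monotone (suc n) f (maxFin f) mono (≤-maxFin f) (Nat.s≤s (Subsetₚ.∣p∣≤n (below f (maxFin f)))))
    where
      f : Point n
      f v = σ v * y v
      Φf≡ : Φ f ≡ dot y x
      Φf≡ = sum-cong (λ v → trans (solve 3 (λ s a y → s :* (s :* a) :* y := (s :* s) :* (a :* y)) refl (σ v) (y v) (x v))
                                 (trans (cong (_* (y v * x v)) (σ² (side v))) (*-identityˡ (y v * x v))))
        where
          σ² : ∀ b → sgn b * sgn b ≡ 1ℚ
          σ² true  = refl
          σ² false = refl
      mono : Monotone f
      mono i j ij si with side j in sj
      ... | true  = ⊥-elim (bip i j ij (trans si (sym sj)))
      ... | false rewrite si = subst₂ _≤_ (solve 1 (λ a → :- a := con (- 1ℚ) :* a) refl (y j)) (sym (*-identityˡ (y i)))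
                      (0≤q-p⇒p≤q (subst (0ℚ ≤_) (solve 2 (λ a b → a :+ b := a :- (:- b)) refl (y i) (y j)) (y-edge i j ij)))

-- Proportional admissible forms

≢-≢⇒≡ : ∀ {a b c : Bool} → a ≢ b → a ≢ c → b ≡ c
≢-≢⇒≡ a≢b a≢c = trans (Boolₚ.¬-not (λ b≡a → a≢b (sym b≡a))) (sym (Boolₚ.¬-not (λ c≡a → a≢c (sym c≡a))))

module Proportionality {n} (adj : Adj n) (V1 : Subset n) (simple : IsSimple adj) (bip : IsBipartition adj V1)
  (conn : Connected adj) where

  open EdgeSpace adj

  side : Fin n → Bool
  side v = lookup V1 v

  module _ (w : Point n) (w-edge : ∀ i j → adj i j ≡ true → w i + w j ≡ 0ℚ) where

    alternating : ∀ {u v} → Reach adj u v → (side u ≡ side v → w v ≡ w u) × (side u ≢ side v → w v ≡ - w u)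
    alternating here = (λ _ → refl) , (λ u≢u → ⊥-elim (u≢u refl))
    alternating {u} {t} (step {v = v} uv v⇝t) = same , opposite
      where
        wv : w v ≡ - w u
        wv = p+q≡0⇒p≡-q (trans (+-comm (w v) (w u)) (w-edge u v uv))
        same : side u ≡ side t → w t ≡ w u
        same ut = trans (proj₂ (alternating v⇝t) (λ vt → bip u v uv (trans ut (sym vt))))
                        (trans (cong -_ wv) (neg-involutive (w u)))
        opposite : side u ≢ side t → w t ≡ - w u
        opposite u≢t = trans (proj₁ (alternating v⇝t) (≢-≢⇒≡ (bip u v uv) u≢t)) wv

    same-side : ∀ u v → side u ≡ side v → w v ≡ w u
    same-side u v = proj₁ (alternating (conn u v))

    opposite-side : ∀ u v → side u ≢ side v → w v ≡ - w u
    opposite-side u v = proj₂ (alternating (conn u v))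

  members : HS n → Fin n → Bool
  members (hA A) v = lookup A v
  members (he _) v = false

  form-V1 : ∀ h → Admissible V1 h → ∀ {v} → side v ≡ true → form h v ≡ ind (members h v)
  form-V1 (hA A) (A⊆V1 , _) {v} v∈V1 with lookup (nbhd adj A) v in v∈N
  ... | false = +-identityʳ (ind (lookup A v))
  ... | true  = let u , u∈A , uv = ∈nbhd⇒adjacent A v∈N in
    ⊥-elim (bip u v uv (trans (∈⇒lookup (A⊆V1 (lookup⇒∈ u∈A))) (sym v∈V1)))
  form-V1 (he j) j∉V1 {v} v∈V1 = cong -_ (δ-diff {k = j} {i = v} λ { refl → j∉V1 (lookup⇒∈ v∈V1) })

  form-empty : ∀ A → (∀ v → lookup A v ≡ false) → ∀ v → form (hA A) v ≡ 0ℚ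
  form-empty A empty v with lookup (nbhd adj A) v in v∈N
  ... | false = cong (λ b → ind b - 0ℚ) (empty v)
  ... | true  = let u , u∈A , _ = ∈nbhd⇒adjacent A v∈N in ⊥-elim (true≢false (trans (sym u∈A) (empty u)))

  form-self : ∀ j → form (he j) j ≡ - 1ℚ
  form-self j = cong -_ (δ-same j)

  form-other : ∀ {j v} → j ≢ v → form (he j) v ≡ 0ℚ
  form-other {j} {v} j≢v = cong -_ (δ-diff {k = j} {i = v} j≢v)

  module Proportional (g h : HS n) (α β : ℚ) (α>0 : 0ℚ < α) (β>0 : 0ℚ < β)
    (prop : ∀ c → α * dot (edgeForm g) c ≡ β * dot (edgeForm h) c) where

    w : Point n
    w v = α * form g v - β * form h v

    w-edge : ∀ i j → adj i j ≡ true → w i + w j ≡ 0ℚ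
    w-edge i j ij = begin
      w i + w j
        ≡⟨ solve 6 (λ a b gi gj hi hj → (a :* gi :- b :* hi) :+ (a :* gj :- b :* hj) := a :* (gi :+ gj) :- b :* (hi :+ hj)) refl
             α β (form g i) (form g j) (form h i) (form h j) ⟩
      α * (form g i + form g j) - β * (form h i + form h j)
        ≡⟨ cong₂ (λ u v → α * u - β * v) (sym (on-edge g)) (sym (on-edge h)) ⟩
      α * dot (edgeForm g) (δ (pair i j)) - β * dot (edgeForm h) (δ (pair i j))
        ≡⟨ cong (_- β * dot (edgeForm h) (δ (pair i j))) (prop (δ (pair i j))) ⟩
      β * dot (edgeForm h) (δ (pair i j)) - β * dot (edgeForm h) (δ (pair i j))
        ≡⟨ +-inverseʳ (β * dot (edgeForm h) (δ (pair i j))) ⟩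
      0ℚ ∎
      where
        open ≡-Reasoning
        on-edge : ∀ f → dot (edgeForm f) (δ (pair i j)) ≡ form f i + form f j
        on-edge f = trans (dot-δʳ (edgeForm f) (pair i j)) (pullback-pair (form f) i j ij)

    w-V1 : Admissible V1 g → Admissible V1 h → ∀ {v} → side v ≡ true → w v ≡ α * ind (members g v) - β * ind (members h v)
    w-V1 g-adm h-adm v∈V1 = cong₂ (λ u t → α * u - β * t) (form-V1 g g-adm v∈V1) (form-V1 h h-adm v∈V1)

    ≡w : ∀ u v → side u ≡ side v → w v ≡ w u
    ≡w = same-side w w-edge

    -w : ∀ u v → side u ≢ side v → w v ≡ - w u
    -w = opposite-side w w-edge

    weights-zero : ∀ a b → α * ind a - β * ind b ≡ 0ℚ → a ≡ b
    weights-zero true  true  _ = refl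
    weights-zero false false _ = refl
    weights-zero true  false e = ⊥-elim (pos⇒≢0 α>0 (trans (solve 2 (λ a b → a := a :* con 1ℚ :- b :* con 0ℚ) refl α β) e))
    weights-zero false true  e =
      ⊥-elim (pos⇒≢0 β>0 (trans (solve 2 (λ a b → b := :- (a :* con 0ℚ :- b :* con 1ℚ)) refl α β) (cong -_ e)))

    level-zero : ∀ {s} a b → α * ind false - β * ind b ≡ s → α * ind a - β * ind false ≡ s → s ≡ 0ℚ
    level-zero a false e _ = trans (sym e) (solve 2 (λ a b → a :* con 0ℚ :- b :* con 0ℚ := con 0ℚ) refl α β)
    level-zero false true _ e = trans (sym e) (solve 2 (λ a b → a :* con 0ℚ :- b :* con 0ℚ := con 0ℚ) refl α β)
    level-zero true true e₁ e₂ = ⊥-elim (<-asym α>0 (subst (_< 0ℚ) (sym α≡-β) (neg-antimono-< β>0)))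
      where
        α≡-β : α ≡ - β
        α≡-β = trans (solve 2 (λ a b → a := a :* con 1ℚ :- b :* con 0ℚ) refl α β)
                     (trans e₂ (trans (sym e₁) (solve 2 (λ a b → a :* con 0ℚ :- b :* con 1ℚ := :- b) refl α β)))

  outside-V1 : ∀ {A : Subset n} → A S.⊆ V1 → ∀ {v} → side v ≡ false → lookup A v ≡ false
  outside-V1 {A} A⊆V1 {v} v∉V1 with lookup A v in v∈A
  ... | false = refl
  ... | true  = ⊥-elim (true≢false (trans (sym (∈⇒lookup (A⊆V1 (lookup⇒∈ v∈A)))) v∉V1))

  subset-ext : ∀ {A B : Subset n} → (∀ v → lookup A v ≡ lookup B v) → A ≡ B
  subset-ext {A} {B} A≗B = trans (sym (Vecₚ.tabulate∘lookup A)) (trans (Vecₚ.tabulate-cong A≗B) (Vecₚ.tabulate∘lookup B))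

  module _ (α β : ℚ) (α>0 : 0ℚ < α) (β>0 : 0ℚ < β) where

    hA-hA : ∀ A B → (∀ c → α * dot (edgeForm (hA A)) c ≡ β * dot (edgeForm (hA B)) c) → A ⊂ V1 → B ⊂ V1 → A ≡ B
    hA-hA A B prop A-adm@(A⊆V1 , i₀ , i₀∈V1 , i₀∉A) B-adm@(B⊆V1 , i₁ , i₁∈V1 , i₁∉B) = subset-ext same
      where
        open Proportional (hA A) (hA B) α β α>0 β>0 prop
        w≡ = w-V1 A-adm B-adm
        w₀≡0 : w i₀ ≡ 0ℚ
        w₀≡0 = level-zero (lookup A i₁) (lookup B i₀)
          (trans (cong (λ a → α * ind a - β * ind (lookup B i₀)) (sym (∉⇒lookup i₀∉A)))
                 (sym (w≡ (∈⇒lookup i₀∈V1))))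
          (trans (cong (λ b → α * ind (lookup A i₁) - β * ind b) (sym (∉⇒lookup i₁∉B)))
                 (trans (sym (w≡ (∈⇒lookup i₁∈V1)))
                        (≡w i₀ i₁ (trans (∈⇒lookup i₀∈V1) (sym (∈⇒lookup i₁∈V1))))))
        same : ∀ v → lookup A v ≡ lookup B v
        same v with side v in v∈V1
        ... | true  = weights-zero (lookup A v) (lookup B v)
                        (trans (sym (w≡ v∈V1)) (trans (≡w i₀ v (trans (∈⇒lookup i₀∈V1) (sym v∈V1))) w₀≡0))
        ... | false = trans (outside-V1 A⊆V1 v∈V1) (sym (outside-V1 B⊆V1 v∈V1))

    hA-he : ∀ A j → (∀ c → α * dot (edgeForm (hA A)) c ≡ β * dot (edgeForm (he j)) c) → A ⊂ V1 → j S.∉ V1 → ⊥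
    hA-he A j prop A-adm@(A⊆V1 , i₀ , i₀∈V1 , i₀∉A) j∉V1 = pos⇒≢0 β>0 (trans (sym wj≡β) wj≡0)
      where
        open Proportional (hA A) (he j) α β α>0 β>0 prop
        w≡ = w-V1 A-adm j∉V1
        w₀≡0 : w i₀ ≡ 0ℚ
        w₀≡0 = trans (w≡ (∈⇒lookup i₀∈V1))
          (trans (cong (λ a → α * ind a - β * 0ℚ) (∉⇒lookup i₀∉A))
                 (solve 2 (λ a b → a :* con 0ℚ :- b :* con 0ℚ := con 0ℚ) refl α β))
        empty : ∀ v → lookup A v ≡ false
        empty v with side v in v∈V1
        ... | true  = weights-zero (lookup A v) false
                        (trans (sym (w≡ v∈V1)) (trans (≡w i₀ v (trans (∈⇒lookup i₀∈V1) (sym v∈V1))) w₀≡0))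
        ... | false = outside-V1 A⊆V1 v∈V1
        wj≡β : w j ≡ β
        wj≡β = trans (cong₂ (λ u t → α * u - β * t) (form-empty A empty j) (form-self j))
                     (solve 2 (λ a b → a :* con 0ℚ :- b :* (:- con 1ℚ) := b) refl α β)
        wj≡0 : w j ≡ 0ℚ
        wj≡0 = trans (-w i₀ j (λ e → j∉V1 (lookup⇒∈ (trans (sym e) (∈⇒lookup i₀∈V1))))) (cong -_ w₀≡0)

    he-he : ∀ j j′ → (∀ c → α * dot (edgeForm (he j)) c ≡ β * dot (edgeForm (he j′)) c) →
      j S.∉ V1 → j′ S.∉ V1 → j ≡ j′
    he-he j j′ prop j∉V1 j′∉V1 with j Finₚ.≟ j′
    ... | yes j≡j′ = j≡j′
    ... | no j≢j′ = ⊥-elim (<-asym β>0 (subst (_< 0ℚ) (sym β≡-α) (neg-antimono-< α>0)))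
      where
        open Proportional (he j) (he j′) α β α>0 β>0 prop
        β≡-α : β ≡ - α
        β≡-α = begin
          β      ≡⟨ solve 2 (λ a b → b := a :* con 0ℚ :- b :* (:- con 1ℚ)) refl α β ⟩
          α * 0ℚ - β * - 1ℚ ≡⟨ sym (cong₂ (λ u t → α * u - β * t) (form-other j≢j′) (form-self j′)) ⟩
          w j′   ≡⟨ ≡w j j′ (trans (∉⇒lookup j∉V1) (sym (∉⇒lookup j′∉V1))) ⟩
          w j    ≡⟨ cong₂ (λ u t → α * u - β * t) (form-self j) (form-other (λ e → j≢j′ (sym e))) ⟩
          α * - 1ℚ - β * 0ℚ ≡⟨ solve 2 (λ a b → a :* (:- con 1ℚ) :- b :* con 0ℚ := :- a) refl α β ⟩
          - α    ∎
          where open ≡-Reasoning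

  proportional⇒≡ : ∀ g h α β → 0ℚ < α → 0ℚ < β → (∀ c → α * dot (edgeForm g) c ≡ β * dot (edgeForm h) c) →
    Admissible V1 g → Admissible V1 h → g ≡ h
  proportional⇒≡ (hA A) (hA B)  α β α>0 β>0 prop g-adm h-adm = cong hA (hA-hA α β α>0 β>0 A B prop g-adm h-adm)
  proportional⇒≡ (hA A) (he j)  α β α>0 β>0 prop g-adm h-adm = ⊥-elim (hA-he α β α>0 β>0 A j prop g-adm h-adm)
  proportional⇒≡ (he j) (hA A)  α β α>0 β>0 prop g-adm h-adm =
    ⊥-elim (hA-he β α β>0 α>0 A j (λ c → sym (prop c)) h-adm g-adm)
  proportional⇒≡ (he j) (he j′) α β α>0 β>0 prop g-adm h-adm = cong he (he-he α β α>0 β>0 j j′ prop g-adm h-adm)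

-- Irreducible representations

_≟HS_ : ∀ {n} → DecidableEquality (HS n)
hA A ≟HS hA B with Vecₚ.≡-dec Bool._≟_ A B
... | yes refl = yes refl
... | no A≢B   = no λ { refl → A≢B refl }
hA _ ≟HS he _ = no λ ()
he _ ≟HS hA _ = no λ ()
he i ≟HS he j with i Finₚ.≟ j
... | yes refl = yes refl
... | no i≢j   = no λ { refl → i≢j refl }

allSubsets : ∀ m → List (Subset m)
allSubsets zero    = Vec.[] ∷ []
allSubsets (suc m) = map (true Vec.∷_) (allSubsets m) ++ map (false Vec.∷_) (allSubsets m)

∈-allSubsets : ∀ {m} (A : Subset m) → A ∈ allSubsets m
∈-allSubsets Vec.[]               = here refl
∈-allSubsets {suc m} (true Vec.∷ A)  = ∈-++⁺ˡ (∈-map⁺ (true Vec.∷_) (∈-allSubsets A))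
∈-allSubsets {suc m} (false Vec.∷ A) = ∈-++⁺ʳ (map (true Vec.∷_) (allSubsets m)) (∈-map⁺ (false Vec.∷_) (∈-allSubsets A))

∈-removeAt : ∀ {A : Set} (xs : List A) (k : Fin (length xs)) {y} → Unique xs → y ∈ removeAt xs k →
  y ∈ xs × y ≢ List.lookup xs k
∈-removeAt (x ∷ xs) zero    (x∉xs ∷ _) y∈ = there y∈ , λ { refl → All.lookup x∉xs y∈ refl }
∈-removeAt (x ∷ xs) (suc k) (x∉xs ∷ _) (here refl) =
  here refl , λ x≡ → All.lookup x∉xs (subst (_∈ xs) (sym x≡) (∈-lookup k)) refl
∈-removeAt (x ∷ xs) (suc k) (_ ∷ u) (there y∈) = let y∈xs , y≢ = ∈-removeAt xs k u y∈ in there y∈xs , y≢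

∈⇒∈-removeAt : ∀ {A : Set} (xs : List A) (k : Fin (length xs)) {y} → y ∈ xs → y ≢ List.lookup xs k → y ∈ removeAt xs k
∈⇒∈-removeAt (x ∷ xs) zero    (here refl) y≢ = ⊥-elim (y≢ refl)
∈⇒∈-removeAt (x ∷ xs) zero    (there y∈)  y≢ = y∈
∈⇒∈-removeAt (x ∷ xs) (suc k) (here refl) y≢ = here refl
∈⇒∈-removeAt (x ∷ xs) (suc k) (there y∈)  y≢ = there (∈⇒∈-removeAt xs k y∈ y≢)

module Representation {n} (adj : Adj n) (V1 : Subset n) (simple : IsSimple adj) (bip : IsBipartition adj V1) where

  open EdgeSpace adj

  Sufficient : List (HS n) → Set
  Sufficient L = ∀ x → Aff (EdgeCone adj) x → (∀ g → g ∈ L → Halfspace adj g x) → EdgeCone adj x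

  sufficient-⊆ : ∀ {L L′} → L ⊆ L′ → Sufficient L → Sufficient L′
  sufficient-⊆ L⊆L′ suff x x∈aff x∈H = suff x x∈aff (λ g g∈ → x∈H g (L⊆L′ g∈))

  sufficient⇒represents : ∀ {L} → Sufficient L → Represents adj (EdgeCone adj) L
  sufficient⇒represents suff x = mk⇔
    (λ x∈ → ∈-Aff x∈ , All.tabulate (λ {g} _ → halfspace-valid simple g x∈))
    (λ (x∈aff , x∈H) → suff x x∈aff (λ g g∈ → All.lookup x∈H g∈))

  represents⇒sufficient : ∀ {L} → Represents adj (EdgeCone adj) L → Sufficient L
  represents⇒sufficient rep x x∈aff x∈H = Equivalence.from (rep x) (x∈aff , All.tabulate (λ {g} g∈ → x∈H g g∈))

  sufficient-boundary : ∀ {L} → Sufficient L → ∀ c → (∀ g → g ∈ L → dot (edgeForm g) c ≤ 0ℚ) →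
    EdgeCone adj (boundary c)
  sufficient-boundary suff c c∈H =
    suff (boundary c) (boundary⇒aff c) (λ g g∈ → Equivalence.from (halfspace⇔edgeForm g c) (c∈H g g∈))

  edgeForm-valid : ∀ {c} → EdgeCone adj (boundary c) → ∀ h → dot (edgeForm h) c ≤ 0ℚ
  edgeForm-valid {c} c∈ h = Equivalence.to (halfspace⇔edgeForm h c) (halfspace-valid simple h c∈)

  sufficient⇒combination : ∀ {M} → Sufficient M → ∀ h → Combination edgeForm M (edgeForm h)
  sufficient⇒combination {M} suff h with witness⊎combination edgeForm M (edgeForm h)
  ... | inj₂ comb = comb
  ... | inj₁ (c , c∈H , h·c>0) = ⊥-elim (<-irrefl refl (<-≤-trans h·c>0 (edgeForm-valid (sufficient-boundary suff c c∈H) h)))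

  edgeCone-resp : ∀ {x y} → (∀ k → x k ≡ y k) → EdgeCone adj y → EdgeCone adj x
  edgeCone-resp x≡y (C , C≥0 , C-off , y≡) = C , C≥0 , C-off , λ k → trans (x≡y k) (y≡ k)

  ∉V1? : ∀ j → Dec (j S.∉ V1)
  ∉V1? j = ¬? (j Subsetₚ.∈? V1)

  admissibleHalfspaces : List (HS n)
  admissibleHalfspaces = map hA (filter (Subsetₚ._⊂? V1) (allSubsets n)) ++ map he (filter ∉V1? (allFin n))

  admissible⇒∈ : ∀ h → Admissible V1 h → h ∈ admissibleHalfspaces
  admissible⇒∈ (hA A) A⊂V1 = ∈-++⁺ˡ (∈-map⁺ hA (∈-filter⁺ (Subsetₚ._⊂? V1) (∈-allSubsets A) A⊂V1))
  admissible⇒∈ (he j) j∉V1 = ∈-++⁺ʳ (map hA (filter (Subsetₚ._⊂? V1) (allSubsets n)))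
    (∈-map⁺ he (∈-filter⁺ ∉V1? (∈-allFin j) j∉V1))

  ∈⇒admissible : ∀ {h} → h ∈ admissibleHalfspaces → Admissible V1 h
  ∈⇒admissible h∈ with ∈-++⁻ (map hA (filter (Subsetₚ._⊂? V1) (allSubsets n))) h∈
  ... | inj₁ h∈A with ∈-map⁻ hA h∈A
  ...   | A , A∈ , refl = proj₂ (∈-filter⁻ (Subsetₚ._⊂? V1) {xs = allSubsets n} A∈)
  ∈⇒admissible h∈ | inj₂ h∈e with ∈-map⁻ he h∈e
  ...   | j , j∈ , refl = proj₂ (∈-filter⁻ ∉V1? {xs = allFin n} j∈)

  -- A point of the affine hull satisfying Hall's inequalities pairs nonnegatively with the dual
  -- cone, so Farkas' lemma puts it in the edge cone.
  admissibleHalfspaces-sufficient : Sufficient admissibleHalfspaces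
  admissibleHalfspaces-sufficient x x∈aff x∈H with farkas incidence x
  ... | inj₁ (c , c≥0 , x≡) = edgeCone-resp x≡ (boundary⇒edgeCone c c≥0)
  ... | inj₂ (y , y-dual , x·y>0) = ⊥-elim (<-irrefl refl (<-≤-trans x·y>0 x·y≤0))
    where
      c₀ = proj₁ (aff⇒boundary x∈aff)
      open HallInequalities adj V1 simple bip x c₀ (proj₂ (aff⇒boundary x∈aff))
        (λ A A⊂V1 → x∈H (hA A) (admissible⇒∈ (hA A) A⊂V1)) (λ j j∉V1 → x∈H (he j) (admissible⇒∈ (he j) j∉V1))
      -y-edge : ∀ i j → adj i j ≡ true → 0ℚ ≤ - y i + - y j
      -y-edge i j ij = subst (0ℚ ≤_) (neg-distrib-+ (y i) (y j))
        (neg-antimono-≤ (subst (_≤ 0ℚ) (pullback-pair y i j ij) (y-dual (pair i j))))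
      x·y≤0 : dot x y ≤ 0ℚ
      x·y≤0 = subst (_≤ 0ℚ) (dot-comm y x)
        (0≤-p⇒p≤0 (subst (0ℚ ≤_) (dot-negˡ y x) (hall⇒dual-nonNeg (λ v → - y v) -y-edge)))

  Essential : List (HS n) → HS n → Set
  Essential L h =
    Σ (Fin Pairs → ℚ) λ c → (∀ g → g ∈ L → g ≢ h → dot (edgeForm g) c ≤ 0ℚ) × 0ℚ < dot (edgeForm h) c

  essential-⊆ : ∀ {L L′ h} → L′ ⊆ L → Essential L h → Essential L′ h
  essential-⊆ L′⊆L (c , c∈H , h·c>0) = c , (λ g g∈ g≢h → c∈H g (L′⊆L g∈) g≢h) , h·c>0

  record Irredundant (L : List (HS n)) : Set where
    field
      sufficient : Sufficient L
      admissible : All (Admissible V1) L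
      essential  : ∀ h → h ∈ L → Essential L h
      unique     : Unique L

  prune : ∀ K R → Sufficient (K ++ R) → All (Admissible V1) (K ++ R) → (∀ h → h ∈ K → Essential (K ++ R) h) → Unique K →
    Σ (List (HS n)) Irredundant
  prune K [] suff adm ess uniq rewrite ++-identityʳ K =
    K , record { sufficient = suff ; admissible = adm ; essential = ess ; unique = uniq }
  prune K (h ∷ R) suff adm ess uniq with witness⊎combination edgeForm (K ++ R) (edgeForm h)
  ... | inj₁ (c , c∈H , h·c>0) =
    prune (h ∷ K) R (sufficient-⊆ (⊆ₚ.⊆-reflexive-↭ (shift h K R)) suff)
      (All-resp-↭ (shift h K R) adm)
      (λ { g (here refl) → c , (λ g′ g′∈ g′≢g → c∈H g′ (other g′∈ g′≢g)) , h·c>0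
         ; g (there g∈K) → essential-⊆ (⊆ₚ.⊆-reflexive-↭ (↭-sym (shift h K R))) (ess g g∈K) })
      (Allₚ.¬Any⇒All¬ K (λ h∈K → <-irrefl refl (<-≤-trans h·c>0 (c∈H h (∈-++⁺ˡ h∈K))))  ∷ uniq)
    where
      other : ∀ {g′} → g′ ∈ h ∷ K ++ R → g′ ≢ h → g′ ∈ K ++ R
      other (here refl) g′≢h = ⊥-elim (g′≢h refl)
      other (there g′∈) _    = g′∈
  ... | inj₂ comb = prune K R suff′ (⊆ₚ.All-resp-⊇ K++R⊆ adm) (λ g g∈K → essential-⊆ K++R⊆ (ess g g∈K)) uniq
    where
      K++R⊆ : K ++ R ⊆ K ++ h ∷ R
      K++R⊆ = ⊆ₚ.++⁺ʳ K (⊆ₚ.xs⊆x∷xs R h)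
      suff′ : Sufficient (K ++ R)
      suff′ x x∈aff x∈H = suff x x∈aff x∈H′
        where
          c = proj₁ (aff⇒boundary x∈aff)
          x≡ = proj₂ (aff⇒boundary x∈aff)
          c∈H : ∀ g → g ∈ K ++ R → dot (edgeForm g) c ≤ 0ℚ
          c∈H g g∈ = Equivalence.to (halfspace⇔edgeForm g c) (halfspace-resp g (λ k → sym (x≡ k)) (x∈H g g∈))
          x∈H′ : ∀ g → g ∈ K ++ h ∷ R → Halfspace adj g x
          x∈H′ g g∈ with ⊆ₚ.⊆-reflexive-↭ (shift h K R) g∈
          ... | here refl = halfspace-resp g x≡ (Equivalence.from (halfspace⇔edgeForm g c) (combination-implies edgeForm comb c∈H))
          ... | there g∈′ = x∈H g g∈′

  irredundant-exists : Σ (List (HS n)) Irredundant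
  irredundant-exists = prune [] admissibleHalfspaces admissibleHalfspaces-sufficient
    (All.tabulate ∈⇒admissible) (λ _ ()) []

  irredundant⇒irreducible : ∀ {L} → Irredundant L → GoodRep adj V1 L
  irredundant⇒irreducible {L} irr = (sufficient⇒represents sufficient , not-removable) , admissible
    where
      open Irredundant irr
      not-removable : ∀ k → ¬ Represents adj (EdgeCone adj) (removeAt L k)
      not-removable k rep =
        <-irrefl refl (<-≤-trans h·c>0 (edgeForm-valid (sufficient-boundary (represents⇒sufficient rep) c c∈H) h))
        where
          h = List.lookup L k
          ess = essential h (∈-lookup k)
          c = proj₁ ess
          h·c>0 = proj₂ (proj₂ ess)
          c∈H : ∀ g → g ∈ removeAt L k → dot (edgeForm g) c ≤ 0ℚ
          c∈H g g∈ = let g∈L , g≢h = ∈-removeAt L k unique g∈ in proj₁ (proj₂ ess) g g∈L g≢h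

  module Uniqueness (conn : Connected adj) {L : List (HS n)} (irr : Irredundant L) where

    open Irredundant irr
    open Proportionality adj V1 simple bip conn using (proportional⇒≡)

    ones : Fin Pairs → ℚ
    ones _ = 1ℚ

    -- edgeForm k is entrywise nonpositive and, being essential, not identically zero.
    ones-inside : ∀ k → k ∈ L → dot (edgeForm k) ones < 0ℚ
    ones-inside k k∈L with sign (dot (edgeForm k) ones)
    ... | inj₁ k·1<0 = k·1<0
    ... | inj₂ (inj₂ k·1>0) = ⊥-elim (<-irrefl refl (<-≤-trans k·1>0 (edgeForm-nonNeg-nonPos simple k ones (λ _ → 0≤1))))
    ... | inj₂ (inj₁ k·1≡0) = ⊥-elim (<-irrefl (sym k·c≡0) (proj₂ (proj₂ (essential k k∈L))))
      where
        c = proj₁ (essential k k∈L)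
        k≡0 : ∀ e → edgeForm k e ≡ 0ℚ
        k≡0 e = trans (sym (*-identityʳ (edgeForm k e)))
          (sum-nonPos≡0 (λ e → *-nonPos-nonNeg (edgeForm-nonPos simple k e) 0≤1) k·1≡0 e)
        k·c≡0 : dot (edgeForm k) c ≡ 0ℚ
        k·c≡0 = sum-zero (λ e → trans (cong (_* c e) (k≡0 e)) (*-zeroˡ (c e)))

    positive-term : ∀ {M b c} (comb : Combination edgeForm M b) → 0ℚ < dot b c →
      Σ (ℚ × HS n) λ t → t ∈ Combination.terms comb × proj₂ t ∈ M × 0ℚ < proj₁ t × 0ℚ < dot (edgeForm (proj₂ t)) c
    positive-term {c = c} comb b·c>0 =
      let t , t∈ , w>0 , g·c>0 = find (weightedSum-pos edgeForm terms (All.map proj₂ terms∈)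
                                         (subst (0ℚ <_) (identity c) (*-pos scale>0 b·c>0)))
      in t , t∈ , proj₁ (All.lookup terms∈ t∈) , w>0 , g·c>0
      where open Combination comb

    module Facet (h : HS n) (h∈L : h ∈ L) where

      c : Fin Pairs → ℚ
      c = proj₁ (essential h h∈L)

      h·c>0 : 0ℚ < dot (edgeForm h) c
      h·c>0 = proj₂ (proj₂ (essential h h∈L))

      -- A point on the facet of h, strictly inside the facets of all the other members of L.
      z : Fin Pairs → ℚ
      z e = - dot (edgeForm h) ones * c e + dot (edgeForm h) c * ones e

      h·z≡0 : dot (edgeForm h) z ≡ 0ℚ
      h·z≡0 = trans (dot-linearʳ (edgeForm h) (- dot (edgeForm h) ones) (dot (edgeForm h) c) c ones)
        (solve 2 (λ F b → (:- F) :* b :+ b :* F := con 0ℚ) refl (dot (edgeForm h) ones) (dot (edgeForm h) c))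

      k·z<0 : ∀ k → k ∈ L → k ≢ h → dot (edgeForm k) z < 0ℚ
      k·z<0 k k∈L k≢h = subst (_< 0ℚ) (sym (dot-linearʳ (edgeForm k) (- dot (edgeForm h) ones) (dot (edgeForm h) c) c ones))
        (+-mono-≤-< (*-nonNeg-nonPos (<⇒≤ (neg-antimono-< (ones-inside h h∈L)))
                                     (proj₁ (proj₂ (essential h h∈L)) k k∈L k≢h))
                    (*-pos-neg h·c>0 (ones-inside k k∈L)))

      z∈cone : EdgeCone adj (boundary z)
      z∈cone = sufficient-boundary sufficient z k·z≤0
        where
          k·z≤0 : ∀ k → k ∈ L → dot (edgeForm k) z ≤ 0ℚ
          k·z≤0 k k∈L with k ≟HS h
          ... | yes refl = ≤-reflexive h·z≡0
          ... | no k≢h   = <⇒≤ (k·z<0 k k∈L k≢h)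

      terms-vanish : ∀ {M b} (comb : Combination edgeForm M b) → dot b z ≡ 0ℚ →
        All (λ t → term edgeForm t z ≡ 0ℚ) (Combination.terms comb)
      terms-vanish comb b·z≡0 = weightedSum-nonPos≡0 edgeForm terms
        (All.map (λ {t} t∈ → *-nonNeg-nonPos (proj₂ t∈) (edgeForm-valid z∈cone (proj₂ t))) terms∈)
        (trans (sym (identity z)) (trans (cong (scale *_) b·z≡0) (*-zeroʳ scale)))
        where open Combination comb

      -- Members of L other than h are negative at z, so they carry no weight.
      vanishing⇒multiple : ∀ {g} (comb : Combination edgeForm L (edgeForm g)) → dot (edgeForm g) z ≡ 0ℚ →
        ∀ c′ → Combination.scale comb * dot (edgeForm g) c′ ≡
               totalWeight edgeForm (Combination.terms comb) * dot (edgeForm h) c′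
      vanishing⇒multiple comb g·z≡0 c′ = trans (identity c′)
        (weightedSum-collapse edgeForm (edgeForm h) terms
          (All.zipWith (λ (t∈ , t≡0) → only-h t∈ t≡0) (terms∈ , terms-vanish comb g·z≡0)))
        where
          open Combination comb
          only-h : ∀ {t} → proj₂ t ∈ L × 0ℚ ≤ proj₁ t → term edgeForm t z ≡ 0ℚ →
            term edgeForm t c′ ≡ proj₁ t * dot (edgeForm h) c′
          only-h {w , k} (k∈L , _) wk·z≡0 with k ≟HS h
          ... | yes refl = refl
          ... | no k≢h   = begin
            w * dot (edgeForm k) c′  ≡⟨ cong (_* dot (edgeForm k) c′) w≡0 ⟩
            0ℚ * dot (edgeForm k) c′ ≡⟨ *-zeroˡ (dot (edgeForm k) c′) ⟩
            0ℚ                       ≡⟨ sym (*-zeroˡ (dot (edgeForm h) c′)) ⟩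
            0ℚ * dot (edgeForm h) c′ ≡⟨ cong (_* dot (edgeForm h) c′) (sym w≡0) ⟩
            w * dot (edgeForm h) c′  ∎
            where
              open ≡-Reasoning
              w≡0 : w ≡ 0ℚ
              w≡0 = p*neg≡0⇒p≡0 (k·z<0 k k∈L k≢h) wk·z≡0

    module _ (L′ : List (HS n)) (good : GoodRep adj V1 L′) where

      sufficient′ : Sufficient L′
      sufficient′ = represents⇒sufficient (proj₁ (proj₁ good))

      admissible′ : All (Admissible V1) L′
      admissible′ = proj₂ good

      -- Write h as a combination of L′ and pick a member g that is positive at the witness of h.
      -- It vanishes on the facet point of h, so writing g as a combination of L shows g ∝ h.
      ⊆L′ : ∀ h → h ∈ L → h ∈ L′
      ⊆L′ h h∈L = subst (_∈ L′) g≡h g∈L′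
        where
          open Facet h h∈L
          comb₁ : Combination edgeForm L′ (edgeForm h)
          comb₁ = sufficient⇒combination sufficient′ h
          picked = positive-term comb₁ h·c>0
          g : HS n
          g = proj₂ (proj₁ picked)
          g∈L′ : g ∈ L′
          g∈L′ = proj₁ (proj₂ (proj₂ picked))
          g·c>0 : 0ℚ < dot (edgeForm g) c
          g·c>0 = proj₂ (proj₂ (proj₂ (proj₂ picked)))
          g·z≡0 : dot (edgeForm g) z ≡ 0ℚ
          g·z≡0 = pos*q≡0⇒q≡0 (proj₁ (proj₂ (proj₂ (proj₂ picked))))
                    (All.lookup (terms-vanish comb₁ h·z≡0) (proj₁ (proj₂ picked)))
          comb₂ : Combination edgeForm L (edgeForm g)
          comb₂ = sufficient⇒combination sufficient g
          open Combination comb₂ using (scale; scale>0; terms; terms∈)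
          β : ℚ
          β = totalWeight edgeForm terms
          g∝h : ∀ c′ → scale * dot (edgeForm g) c′ ≡ β * dot (edgeForm h) c′
          g∝h = vanishing⇒multiple {g} comb₂ g·z≡0
          β>0 : 0ℚ < β
          β>0 = proj₁ (*-pos-factors (totalWeight-nonNeg edgeForm terms (All.map proj₂ terms∈))
                                     (subst (0ℚ <_) (g∝h c) (*-pos scale>0 g·c>0)))
          g≡h : g ≡ h
          g≡h = proportional⇒≡ g h scale β scale>0 β>0 g∝h (All.lookup admissible′ g∈L′) (All.lookup admissible h∈L)

      ⊆L : ∀ h → h ∈ L′ → h ∈ L
      ⊆L h h∈L′ with Any.any? (h ≟HS_) L
      ... | yes h∈L = h∈L
      ... | no h∉L = ⊥-elim (proj₂ (proj₁ good) k (sufficient⇒represents (sufficient-⊆ L⊆ sufficient)))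
        where
          k = Any.index h∈L′
          L⊆ : L ⊆ removeAt L′ k
          L⊆ {g} g∈L = ∈⇒∈-removeAt L′ k (⊆L′ g g∈L)
            (λ g≡ → h∉L (subst (_∈ L) (trans g≡ (sym (Anyₚ.lookup-index h∈L′))) g∈L))

      same-members : SameMembers L L′
      same-members h = mk⇔ (⊆L′ h) (⊆L h)

theorem4p9 : (n : ℕ) (adj : Adj n) (V1 : Subset n) →
    IsSimple adj → Connected adj → IsBipartition adj V1 →
    Σ (List (HS n)) λ L →
      GoodRep adj V1 L × (∀ (L' : List (HS n)) → GoodRep adj V1 L' → SameMembers L L')
theorem4p9 n adj V1 simple conn bip =
  L , irredundant⇒irreducible irr , Uniqueness.same-members conn irr
  where
    open Representation adj V1 simple bip
    L = proj₁ irredundant-exists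
    irr = proj₂ irredundant-exists
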